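{- Let $n\ge1$ and let $\mathbf{k}\in\mathbb{Z}^n$ be strictly increasing. There exists a sijection $\mathrm{MT}(\mathbf{k})\Rightarrow\mathrm{GMT}(\mathbf{k})$ that is compatible with the statistic $\eta_{\mathrm{MT}}$. Here: - $\eta_{\mathrm{MT}}(s)=s$ for $s\in\mathrm{MT}(\mathbf{k})$; - $\eta_{\mathrm{MT}}(\mathbf{k}^{(n)},\mu^{(n)},\dots,\mathbf{k}^{(1)},\mu^{(1)})=(\mathbf{k}^{(1)},\dots,\mathbf{k}^{(n)})$ for elements of $\mathrm{GMT}(\mathbf{k})$.
   Context: Signed sets $S=(S^+,S^-)$ are pairs of disjoint finite sets with support $|S|=S^+\sqcup S^-$. The Cartesian product is $S\times T=(S^+\times T^+\sqcup S^-\times T^-,\ S^+\times T^-\sqcup S^-\times T^+)$. The disjoint union with signed index is $\bigsqcup_{t\in T}S_t=(\bigsqcup_{t\in T^+}S_t^+\sqcup\bigsqcup_{t\in T^- }S_t^-,\ \bigsqcup_{t\in T^+}S_t^-\sqcup\bigsqcup_{t\in T^- }S_t^+)$. A sijection $\varphi:S\Rightarrow T$ is an involution on $|S|\sqcup|T|$ mapping $S^+\sqcup T^-$ onto $S^-\sqcup T^+$. It is compatible with $\eta$ if $\eta(\varphi(s))=\eta(s)$ for all $s$. The signed interval $[a,b)$ is $([a,b)\cap\mathbb{Z},\emptyset)$ if $a<b$, $(\emptyset,\emptyset)$ if $a=b$, and $(\emptyset,[b,a)\cap\mathbb{Z})$ if $a>b$. $\mathrm{MT}(\mathbf{k})=(M,\emptyset)$,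 where $M$ is the set of triangular integer arrays $(a_{i,j})_{1\le j\le i\le n}$ such that: - the bottom row is $(a_{n,1},\dots,a_{n,n})=\mathbf{k}$; - $a_{i+1,j}\le a_{i,j}<a_{i+1,j+1}$ for $1\le j\le i\le n-1$; - $a_{i,j}<a_{i,j+1}-1$ for $1\le j<i\le n-1$. $\mathrm{AR}_n=(\{\nwarrow,\nearrow\},\{\nwarrow\!\!\nearrow\})^n$. Here $\delta_\nwarrow$ is $1$ on $\nwarrow,\nwarrow\!\!\nearrow$ and $0$ on $\nearrow$; $\delta_\nearrow$ is $1$ on $\nearrow,\nwarrow\!\!\nearrow$ and $0$ on $\nwarrow$. Put $\mu(\mathbf{k})=\prod_{i=1}^{n-1}[k_i+\delta_\nearrow(\mu_i),k_{i+1}-\delta_\nwarrow(\mu_{i+1}))$. $\mathrm{GMT}(\mathbf{k})=\mathrm{AR}_1$ for $n=1$, and $\bigsqcup_{\mu\in\mathrm{AR}_n}\bigsqcup_{\mathbf{l}\in\mu(\mathbf{k})}\mathrm{GMT}(\mathbf{l})$ for $n\ge2$. Its elements are sequences $(\mathbf{k}^{(n)}=\mathbf{k},\mu^{(n)},\mathbf{k}^{(n-1)},\dots,\mathbf{k}^{(1)},\mu^{(1)})$ with $\mathbf{k}^{(i)}\in|\mu^{(i+1)}(\mathbf{k}^{(i+1)})|$. Here $(\mathbf{k}^{(1)},\dots,\mathbf{k}^{(n)})$ is regarded as a triangular array. -}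

module Defs where

open import Data.Nat using (ℕ; zero; suc)
open import Data.Integer using (ℤ; _+_; _-_; _≤_; _<_; 0ℤ; 1ℤ)
open import Data.Vec using (Vec; []; _∷_; zipWith; init; tail)
open import Data.Product using (Σ; _×_; _,_; proj₁)
open import Data.Sum using (_⊎_; inj₁; inj₂; [_,_])
open import Data.Unit using (⊤; tt)
open import Data.Empty using (⊥)
open import Data.Bool using (Bool; true; false)
open import Relation.Binary.PropositionalEquality using (_≡_)

record SignedSet : Set₁ where
  constructor _,ˢ_
  field
    Pos : Set
    Neg : Set
open SignedSet public

∣_∣ : SignedSet → Set
∣ S ∣ = Pos S ⊎ Neg S

_×ˢ_ : SignedSet → SignedSet → SignedSet
S ×ˢ T = ((Pos S × Pos T) ⊎ (Neg S × Neg T)) ,ˢ ((Pos S × Neg T) ⊎ (Neg S × Pos T))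

𝟙ˢ : SignedSet
𝟙ˢ = ⊤ ,ˢ ⊥

_^ˢ_ : SignedSet → ℕ → SignedSet
S ^ˢ zero = 𝟙ˢ
S ^ˢ suc n = S ×ˢ (S ^ˢ n)

π₁ : {S T : SignedSet} → ∣ S ×ˢ T ∣ → ∣ S ∣
π₁ (inj₁ (inj₁ (s , _))) = inj₁ s
π₁ (inj₁ (inj₂ (s , _))) = inj₂ s
π₁ (inj₂ (inj₁ (s , _))) = inj₁ s
π₁ (inj₂ (inj₂ (s , _))) = inj₂ s

π₂ : {S T : SignedSet} → ∣ S ×ˢ T ∣ → ∣ T ∣
π₂ (inj₁ (inj₁ (_ , t))) = inj₁ t
π₂ (inj₁ (inj₂ (_ , t))) = inj₂ t
π₂ (inj₂ (inj₁ (_ , t))) = inj₂ t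
π₂ (inj₂ (inj₂ (_ , t))) = inj₁ t

⨆ : (T : SignedSet) → (∣ T ∣ → SignedSet) → SignedSet
⨆ T S =
  (Σ (Pos T) (λ t → Pos (S (inj₁ t))) ⊎ Σ (Neg T) (λ t → Neg (S (inj₂ t))))
  ,ˢ
  (Σ (Pos T) (λ t → Neg (S (inj₁ t))) ⊎ Σ (Neg T) (λ t → Pos (S (inj₂ t))))

index : {T : SignedSet} {S : ∣ T ∣ → SignedSet} → ∣ ⨆ T S ∣ → ∣ T ∣
index (inj₁ (inj₁ (t , _))) = inj₁ t
index (inj₁ (inj₂ (t , _))) = inj₂ t
index (inj₂ (inj₁ (t , _))) = inj₁ t
index (inj₂ (inj₂ (t , _))) = inj₂ t

element : {T : SignedSet} {S : ∣ T ∣ → SignedSet} →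
          (x : ∣ ⨆ T S ∣) → ∣ S (index {T} {S} x) ∣
element (inj₁ (inj₁ (_ , s))) = inj₁ s
element (inj₁ (inj₂ (_ , s))) = inj₂ s
element (inj₂ (inj₁ (_ , s))) = inj₂ s
element (inj₂ (inj₂ (_ , s))) = inj₁ s

-- Signed interval [a,b):
--   ([a,b) ∩ ℤ , ∅) if a < b,  (∅ , ∅) if a = b,  (∅ , [b,a) ∩ ℤ) if a > b.
[_,_⟩ : ℤ → ℤ → SignedSet
[ a , b ⟩ = Σ ℤ (λ x → a ≤ x × x < b) ,ˢ Σ ℤ (λ x → b ≤ x × x < a)

side : {S T : SignedSet} → ∣ S ∣ ⊎ ∣ T ∣ → Bool
side (inj₁ (inj₁ _)) = true
side (inj₁ (inj₂ _)) = false
side (inj₂ (inj₁ _)) = false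
side (inj₂ (inj₂ _)) = true

record Sijection (S T : SignedSet) : Set where
  field
    φ      : ∣ S ∣ ⊎ ∣ T ∣ → ∣ S ∣ ⊎ ∣ T ∣
    invol  : ∀ x → φ (φ x) ≡ x
    into   : ∀ x → side {S} {T} x ≡ true → side {S} {T} (φ x) ≡ false
    onto   : ∀ y → side {S} {T} y ≡ false →
             Σ (∣ S ∣ ⊎ ∣ T ∣) (λ x → side {S} {T} x ≡ true × φ x ≡ y)
open Sijection public

Compatible : {S T : SignedSet} {A : Set} →
             (∣ S ∣ → A) → (∣ T ∣ → A) → Sijection S T → Set
Compatible {S} {T} ηS ηT f = ∀ x → η (φ f x) ≡ η x
  where
    η : ∣ S ∣ ⊎ ∣ T ∣ → _
    η = [ ηS , ηT ]

-- Triangular arrays.  Tri n is an array with rows of lengths 1,…,n+1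
-- (so it has n+1 rows); the last component is the bottom row.

Tri : ℕ → Set
Tri zero    = Vec ℤ 1
Tri (suc n) = Tri n × Vec ℤ (suc (suc n))

bottom : (n : ℕ) → Tri n → Vec ℤ (suc n)
bottom zero    r       = r
bottom (suc n) (_ , b) = b

StrictlyIncreasing : {m : ℕ} → Vec ℤ m → Set
StrictlyIncreasing []            = ⊤
StrictlyIncreasing (_ ∷ [])      = ⊤
StrictlyIncreasing (x ∷ y ∷ r)   = x < y × StrictlyIncreasing (y ∷ r)

Gapped : {m : ℕ} → Vec ℤ m → Set
Gapped []          = ⊤
Gapped (_ ∷ [])    = ⊤
Gapped (x ∷ y ∷ r) = x < y - 1ℤ × Gapped (y ∷ r)

Interlace : {m : ℕ} → Vec ℤ m → Vec ℤ (suc m) → Set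
Interlace []      (_ ∷ [])      = ⊤
Interlace (x ∷ r) (b ∷ b' ∷ bs) = b ≤ x × x < b' × Interlace r (b' ∷ bs)

-- all the monotone-triangle conditions except the bottom row condition
IsMT : (n : ℕ) → Tri n → Set
IsMT zero    _       = ⊤
IsMT (suc n) (t , b) = IsMT n t × Interlace (bottom n t) b × Gapped (bottom n t)

MT : (n : ℕ) → Vec ℤ (suc n) → SignedSet
MT n k = Σ (Tri n) (λ a → bottom n a ≡ k × IsMT n a) ,ˢ ⊥

ηMT : (n : ℕ) (k : Vec ℤ (suc n)) → ∣ MT n k ∣ → Tri n
ηMT n k (inj₁ (a , _)) = a
ηMT n k (inj₂ ())

data Arrow : Set where
  ↖ ↗ ↖↗ : Arrow

data ArPos : Set where
  pos↖ pos↗ : ArPos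

data ArNeg : Set where
  neg↖↗ : ArNeg

AR₁ : SignedSet
AR₁ = ArPos ,ˢ ArNeg

arrow : ∣ AR₁ ∣ → Arrow
arrow (inj₁ pos↖) = ↖
arrow (inj₁ pos↗) = ↗
arrow (inj₂ neg↖↗) = ↖↗

AR : ℕ → SignedSet
AR n = AR₁ ^ˢ n

arrows : (n : ℕ) → ∣ AR n ∣ → Vec Arrow n
arrows zero    _ = []
arrows (suc n) x = arrow (π₁ {AR₁} {AR n} x) ∷ arrows n (π₂ {AR₁} {AR n} x)

δ↖ : Arrow → ℤ
δ↖ ↖  = 1ℤ
δ↖ ↗  = 0ℤ
δ↖ ↖↗ = 1ℤ

δ↗ : Arrow → ℤ
δ↗ ↖  = 0ℤ
δ↗ ↗  = 1ℤ
δ↗ ↖↗ = 1ℤ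

IProd : {m : ℕ} → Vec ℤ m → Vec ℤ m → SignedSet
IProd []       []       = 𝟙ˢ
IProd (a ∷ as) (b ∷ bs) = [ a , b ⟩ ×ˢ IProd as bs

values : {m : ℕ} (as bs : Vec ℤ m) → ∣ IProd as bs ∣ → Vec ℤ m
values []       []       _ = []
values (a ∷ as) (b ∷ bs) x =
  val (π₁ {[ a , b ⟩} {IProd as bs} x) ∷ values as bs (π₂ {[ a , b ⟩} {IProd as bs} x)
  where
    val : ∣ [ a , b ⟩ ∣ → ℤ
    val (inj₁ (v , _)) = v
    val (inj₂ (v , _)) = v

-- lower and upper bounds of μ(k) = ∏_{i} [k_i + δ↗(μ_i), k_{i+1} - δ↖(μ_{i+1}))
lowers : {m : ℕ} → Vec Arrow (suc m) → Vec ℤ (suc m) → Vec ℤ m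
lowers μ k = zipWith (λ ki μi → ki + δ↗ μi) (init k) (init μ)

uppers : {m : ℕ} → Vec Arrow (suc m) → Vec ℤ (suc m) → Vec ℤ m
uppers μ k = zipWith (λ ki μi → ki - δ↖ μi) (tail k) (tail μ)

μ⟨_⟩ : {m : ℕ} → Vec Arrow (suc m) → Vec ℤ (suc m) → SignedSet
μ⟨ μ ⟩ k = IProd (lowers μ k) (uppers μ k)

GMT : (n : ℕ) → Vec ℤ (suc n) → SignedSet
GMT zero    k = AR₁
GMT (suc n) k =
  ⨆ (AR (suc (suc n))) (λ μ →
    ⨆ (μ⟨ arrows (suc (suc n)) μ ⟩ k) (λ l →
      GMT n (values (lowers (arrows (suc (suc n)) μ) k)
                    (uppers (arrows (suc (suc n)) μ) k) l)))

ηGMT : (n : ℕ) (k : Vec ℤ (suc n)) → ∣ GMT n k ∣ → Tri n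
ηGMT zero    k _ = k
ηGMT (suc n) k x = ηGMT n l z , k
  where
    N = suc (suc n)
    Fam : ∣ AR N ∣ → SignedSet
    Fam μ = ⨆ (μ⟨ arrows N μ ⟩ k) (λ l →
              GMT n (values (lowers (arrows N μ) k) (uppers (arrows N μ) k) l))
    μ : ∣ AR N ∣
    μ = index {AR N} {Fam} x
    y : ∣ Fam μ ∣
    y = element {AR N} {Fam} x
    lv : ∣ μ⟨ arrows N μ ⟩ k ∣
    lv = index {μ⟨ arrows N μ ⟩ k}
               {λ l → GMT n (values (lowers (arrows N μ) k) (uppers (arrows N μ) k) l)} y
    l : Vec ℤ (suc n)
    l = values (lowers (arrows N μ) k) (uppers (arrows N μ) k) lv
    z : ∣ GMT n l ∣
    z = element {μ⟨ arrows N μ ⟩ k}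
                {λ l → GMT n (values (lowers (arrows N μ) k) (uppers (arrows N μ) k) l)} y

-- Unfolding GMT(k) = ⨆_μ ⨆_{l ∈ μ(k)} GMT(l), the induction
-- hypothesis applied fibrewise gives a sijection from Cells(k) = ⨆_μ ⨆_{l ∈ μ(k)} MT(l) to GMT(k),
-- and it sends all of Cells(k) into GMT(k) because MT(l) has no negative elements.  On Cells(k)
-- there is a sign-reversing involution whose fixed points are MT(k): given the row l (the bottom
-- row of the triangle from MT(l)), whether l ∈ μ(k), and with which sign, only depends on the
-- arrows and on which entries satisfy l_j = k_j or l_j + 1 = k_{j+1}.  Toggling the leftmost arrow
-- component that does not affect membership flips the sign of μ; the only arrow vector with no such
-- component is a canonical one, which contains l (positively) exactly when l is gapped, and then
-- the triangle on l extended by k is a monotone triangle with bottom row k.  Composing the two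
-- sijections gives MT(k) ⇒ GMT(k).

module Submission where

open import Defs
open import Data.Nat using (ℕ; zero; suc)
open import Data.Integer using (ℤ; _+_; _-_; _≤_; _<_; 1ℤ; pred) renaming (suc to sucℤ)
import Data.Integer as ℤ
import Data.Integer.Properties as ℤ
open import Data.Vec using (Vec; []; _∷_; head)
open import Data.Vec.Properties using (≡-dec; ∷-injectiveˡ; ∷-injectiveʳ)
open import Data.Product using (Σ; Σ-syntax; ∃-syntax; _×_; _,_; proj₁; proj₂; uncurry)
open import Data.Sum using (_⊎_; inj₁; inj₂; [_,_]′)
open import Data.Sum.Properties using ([,]-∘; inj₁-injective; inj₂-injective)
open import Data.Unit using (⊤; tt)
open import Data.Empty using (⊥; ⊥-elim)
open import Data.Bool using (Bool; true; false; not; _xor_)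
open import Data.Bool.Properties using (not-involutive; not-distribˡ-xor; not-distribʳ-xor; xor-identityʳ)
open import Data.Maybe using (Maybe; just; nothing; _<∣>_; zipWith)
open import Data.Maybe.Properties using (just-injective)
import Data.Maybe as Maybe
open import Function using (_∘_)
open import Relation.Binary.PropositionalEquality hiding ([_])
open import Relation.Nullary using (yes; no; does)
open import Relation.Nullary.Decidable using (dec-true; dec-false)
open import Axiom.UniquenessOfIdentityProofs using (module Decidable⇒UIP)

isNeg : {S : SignedSet} → ∣ S ∣ → Bool
isNeg (inj₁ _) = false
isNeg (inj₂ _) = true

side-inj₁ : {S T : SignedSet} (s : ∣ S ∣) → side {S} {T} (inj₁ s) ≡ not (isNeg s)
side-inj₁ (inj₁ _) = refl
side-inj₁ (inj₂ _) = refl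

side-inj₂ : {S T : SignedSet} (t : ∣ T ∣) → side {S} {T} (inj₂ t) ≡ isNeg t
side-inj₂ (inj₁ _) = refl
side-inj₂ (inj₂ _) = refl

module _ {S T : SignedSet} where

  _,×_ : ∣ S ∣ → ∣ T ∣ → ∣ S ×ˢ T ∣
  inj₁ s ,× inj₁ t = inj₁ (inj₁ (s , t))
  inj₂ s ,× inj₂ t = inj₁ (inj₂ (s , t))
  inj₁ s ,× inj₂ t = inj₂ (inj₁ (s , t))
  inj₂ s ,× inj₁ t = inj₂ (inj₂ (s , t))

  π₁-,× : (s : ∣ S ∣) (t : ∣ T ∣) → π₁ {S} {T} (s ,× t) ≡ s
  π₁-,× (inj₁ _) (inj₁ _) = refl
  π₁-,× (inj₁ _) (inj₂ _) = refl
  π₁-,× (inj₂ _) (inj₁ _) = refl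
  π₁-,× (inj₂ _) (inj₂ _) = refl

  π₂-,× : (s : ∣ S ∣) (t : ∣ T ∣) → π₂ {S} {T} (s ,× t) ≡ t
  π₂-,× (inj₁ _) (inj₁ _) = refl
  π₂-,× (inj₁ _) (inj₂ _) = refl
  π₂-,× (inj₂ _) (inj₁ _) = refl
  π₂-,× (inj₂ _) (inj₂ _) = refl

  π₁,π₂ : (x : ∣ S ×ˢ T ∣) → π₁ {S} {T} x ,× π₂ {S} {T} x ≡ x
  π₁,π₂ (inj₁ (inj₁ _)) = refl
  π₁,π₂ (inj₁ (inj₂ _)) = refl
  π₁,π₂ (inj₂ (inj₁ _)) = refl
  π₁,π₂ (inj₂ (inj₂ _)) = refl

  isNeg-,× : (s : ∣ S ∣) (t : ∣ T ∣) → isNeg {S ×ˢ T} (s ,× t) ≡ isNeg s xor isNeg t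
  isNeg-,× (inj₁ _) (inj₁ _) = refl
  isNeg-,× (inj₁ _) (inj₂ _) = refl
  isNeg-,× (inj₂ _) (inj₁ _) = refl
  isNeg-,× (inj₂ _) (inj₂ _) = refl

isNeg-π : {S T : SignedSet} (x : ∣ S ×ˢ T ∣) → isNeg x ≡ isNeg (π₁ {S} {T} x) xor isNeg (π₂ {S} {T} x)
isNeg-π (inj₁ (inj₁ _)) = refl
isNeg-π (inj₁ (inj₂ _)) = refl
isNeg-π (inj₂ (inj₁ _)) = refl
isNeg-π (inj₂ (inj₂ _)) = refl

module _ {T : SignedSet} {S : ∣ T ∣ → SignedSet} where

  pair : Σ ∣ T ∣ (λ t → ∣ S t ∣) → ∣ ⨆ T S ∣
  pair (inj₁ t , inj₁ s) = inj₁ (inj₁ (t , s))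
  pair (inj₂ t , inj₂ s) = inj₁ (inj₂ (t , s))
  pair (inj₁ t , inj₂ s) = inj₂ (inj₁ (t , s))
  pair (inj₂ t , inj₁ s) = inj₂ (inj₂ (t , s))

  unpair : ∣ ⨆ T S ∣ → Σ ∣ T ∣ (λ t → ∣ S t ∣)
  unpair x = index {T} {S} x , element {T} {S} x

  unpair-pair : ∀ p → unpair (pair p) ≡ p
  unpair-pair (inj₁ _ , inj₁ _) = refl
  unpair-pair (inj₂ _ , inj₂ _) = refl
  unpair-pair (inj₁ _ , inj₂ _) = refl
  unpair-pair (inj₂ _ , inj₁ _) = refl

  pair-unpair : ∀ x → pair (unpair x) ≡ x
  pair-unpair (inj₁ (inj₁ _)) = refl
  pair-unpair (inj₁ (inj₂ _)) = refl
  pair-unpair (inj₂ (inj₁ _)) = refl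
  pair-unpair (inj₂ (inj₂ _)) = refl

  isNeg-pair : ∀ t s → isNeg {⨆ T S} (pair (t , s)) ≡ isNeg t xor isNeg s
  isNeg-pair (inj₁ _) (inj₁ _) = refl
  isNeg-pair (inj₂ _) (inj₂ _) = refl
  isNeg-pair (inj₁ _) (inj₂ _) = refl
  isNeg-pair (inj₂ _) (inj₁ _) = refl

  ⨆η : {A : Set} → ((t : ∣ T ∣) → ∣ S t ∣ → A) → ∣ ⨆ T S ∣ → A
  ⨆η η = uncurry η ∘ unpair

  ⨆η-pair : {A : Set} (η : (t : ∣ T ∣) → ∣ S t ∣ → A) → ∀ t s → ⨆η η (pair (t , s)) ≡ η t s
  ⨆η-pair η t s = cong (uncurry η) (unpair-pair (t , s))

inj₂≢inj₁ : {A B : Set} {a : A} {b : B} → inj₂ {A = A} b ≢ inj₁ a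
inj₂≢inj₁ ()

record CompatibleSijection (S T : SignedSet) {A : Set} (ηS : ∣ S ∣ → A) (ηT : ∣ T ∣ → A) : Set where
  field
    σ            : ∣ S ∣ ⊎ ∣ T ∣ → ∣ S ∣ ⊎ ∣ T ∣
    σ-involutive : ∀ x → σ (σ x) ≡ x
    σ-flips      : ∀ x → side {S} {T} (σ x) ≡ not (side {S} {T} x)
    σ-compatible : ∀ x → [ ηS , ηT ]′ (σ x) ≡ [ ηS , ηT ]′ x
open CompatibleSijection

toSijection : {S T : SignedSet} {A : Set} {ηS : ∣ S ∣ → A} {ηT : ∣ T ∣ → A} →
  CompatibleSijection S T ηS ηT → Σ (Sijection S T) (Compatible ηS ηT)
toSijection ψ =
  record { φ     = σ ψ
         ; invol = σ-involutive ψ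
         ; into  = λ x p → trans (σ-flips ψ x) (cong not p)
         ; onto  = λ y p → σ ψ y , trans (σ-flips ψ y) (cong not p) , σ-involutive ψ y }
  , σ-compatible ψ

module _ {S T : SignedSet} {A : Set} {ηS : ∣ S ∣ → A} {ηT : ∣ T ∣ → A}
         (ψ : CompatibleSijection S T ηS ηT) where

  σ-back : ∀ {x y} → σ ψ x ≡ y → σ ψ y ≡ x
  σ-back {x} refl = σ-involutive ψ x

  σ-side : ∀ {x y} → σ ψ x ≡ y → side {S} {T} y ≡ not (side {S} {T} x)
  σ-side {x} refl = σ-flips ψ x

  σ-statistic : ∀ {x y} → σ ψ x ≡ y → [ ηS , ηT ]′ y ≡ [ ηS , ηT ]′ x
  σ-statistic {x} refl = σ-compatible ψ x

  isNeg-across : ∀ {s t} → σ ψ (inj₁ s) ≡ inj₂ t → isNeg t ≡ isNeg s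
  isNeg-across {s} {t} e = begin
    isNeg t                      ≡⟨ side-inj₂ {S} t ⟨
    side {S} {T} (inj₂ t)        ≡⟨ σ-side e ⟩
    not (side {S} {T} (inj₁ s))  ≡⟨ cong not (side-inj₁ {S} {T} s) ⟩
    not (not (isNeg s))          ≡⟨ not-involutive (isNeg s) ⟩
    isNeg s                      ∎
    where open ≡-Reasoning

  isNeg-withinˡ : ∀ {s s′} → σ ψ (inj₁ s) ≡ inj₁ s′ → isNeg s′ ≡ not (isNeg s)
  isNeg-withinˡ {s} {s′} e = begin
    isNeg s′                           ≡⟨ not-involutive (isNeg s′) ⟨
    not (not (isNeg s′))               ≡⟨ cong not (side-inj₁ {S} {T} s′) ⟨
    not (side {S} {T} (inj₁ s′))       ≡⟨ cong not (σ-side e) ⟩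
    not (not (side {S} {T} (inj₁ s)))  ≡⟨ not-involutive _ ⟩
    side {S} {T} (inj₁ s)              ≡⟨ side-inj₁ {S} {T} s ⟩
    not (isNeg s)                      ∎
    where open ≡-Reasoning

  isNeg-withinʳ : ∀ {t t′} → σ ψ (inj₂ t) ≡ inj₂ t′ → isNeg t′ ≡ not (isNeg t)
  isNeg-withinʳ {t} {t′} e = begin
    isNeg t′                     ≡⟨ side-inj₂ {S} t′ ⟨
    side {S} {T} (inj₂ t′)       ≡⟨ σ-side e ⟩
    not (side {S} {T} (inj₂ t))  ≡⟨ cong not (side-inj₂ {S} t) ⟩
    not (isNeg t)                ∎
    where open ≡-Reasoning

  mapStatistic : {B : Set} (f : A → B) → CompatibleSijection S T (f ∘ ηS) (f ∘ ηT)
  mapStatistic f = record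
    { σ            = σ ψ
    ; σ-involutive = σ-involutive ψ
    ; σ-flips      = σ-flips ψ
    ; σ-compatible = λ x → begin
        [ f ∘ ηS , f ∘ ηT ]′ (σ ψ x) ≡⟨ [,]-∘ f (σ ψ x) ⟨
        f ([ ηS , ηT ]′ (σ ψ x))     ≡⟨ cong f (σ-compatible ψ x) ⟩
        f ([ ηS , ηT ]′ x)           ≡⟨ [,]-∘ f x ⟩
        [ f ∘ ηS , f ∘ ηT ]′ x       ∎
    }
    where open ≡-Reasoning

  Forward : Set
  Forward = ∀ s → Σ ∣ T ∣ (λ t → σ ψ (inj₁ s) ≡ inj₂ t)

unsigned-forward : {P : Set} {T : SignedSet} {A : Set} {ηS : ∣ P ,ˢ ⊥ ∣ → A} {ηT : ∣ T ∣ → A}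
  (ψ : CompatibleSijection (P ,ˢ ⊥) T ηS ηT) → Forward ψ
unsigned-forward ψ (inj₁ p) with σ ψ (inj₁ (inj₁ p)) | σ-flips ψ (inj₁ (inj₁ p))
... | inj₁ (inj₁ _) | ()
... | inj₂ t        | _ = t , refl
unsigned-forward ψ (inj₂ ())

module _ {T : SignedSet} {S S′ : ∣ T ∣ → SignedSet} {A : Set}
         {η : (t : ∣ T ∣) → ∣ S t ∣ → A} {η′ : (t : ∣ T ∣) → ∣ S′ t ∣ → A}
         (ψ : (t : ∣ T ∣) → CompatibleSijection (S t) (S′ t) (η t) (η′ t)) where

  private
    Fibres : Set
    Fibres = Σ ∣ T ∣ (λ t → ∣ S t ∣ ⊎ ∣ S′ t ∣)

    split : ∣ ⨆ T S ∣ ⊎ ∣ ⨆ T S′ ∣ → Fibres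
    split (inj₁ x) = index {T} {S} x , inj₁ (element {T} {S} x)
    split (inj₂ x) = index {T} {S′} x , inj₂ (element {T} {S′} x)

    join : Fibres → ∣ ⨆ T S ∣ ⊎ ∣ ⨆ T S′ ∣
    join (t , inj₁ s) = inj₁ (pair {S = S} (t , s))
    join (t , inj₂ s) = inj₂ (pair {S = S′} (t , s))

    split-join : ∀ p → split (join p) ≡ p
    split-join (t , inj₁ s) = cong (λ (t , s) → t , inj₁ s) (unpair-pair {S = S} (t , s))
    split-join (t , inj₂ s) = cong (λ (t , s) → t , inj₂ s) (unpair-pair {S = S′} (t , s))

    join-split : ∀ x → join (split x) ≡ x
    join-split (inj₁ x) = cong inj₁ (pair-unpair {S = S} x)
    join-split (inj₂ x) = cong inj₂ (pair-unpair {S = S′} x)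

    side-join : ∀ t y → side {⨆ T S} {⨆ T S′} (join (t , y)) ≡ isNeg t xor side {S t} {S′ t} y
    side-join t (inj₁ s) = begin
      side {⨆ T S} {⨆ T S′} (inj₁ (pair {S = S} (t , s)))
        ≡⟨ side-inj₁ {⨆ T S} {⨆ T S′} (pair {S = S} (t , s)) ⟩
      not (isNeg {⨆ T S} (pair {S = S} (t , s)))  ≡⟨ cong not (isNeg-pair {S = S} t s) ⟩
      not (isNeg t xor isNeg s)                    ≡⟨ not-distribʳ-xor (isNeg t) (isNeg s) ⟩
      isNeg t xor not (isNeg s)                    ≡⟨ cong (isNeg t xor_) (side-inj₁ {S t} {S′ t} s) ⟨
      isNeg t xor side {S t} {S′ t} (inj₁ s)       ∎
      where open ≡-Reasoning
    side-join t (inj₂ s) = begin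
      side {⨆ T S} {⨆ T S′} (inj₂ (pair {S = S′} (t , s)))  ≡⟨ side-inj₂ {⨆ T S} (pair {S = S′} (t , s)) ⟩
      isNeg {⨆ T S′} (pair {S = S′} (t , s))                 ≡⟨ isNeg-pair {S = S′} t s ⟩
      isNeg t xor isNeg s                                    ≡⟨ cong (isNeg t xor_) (side-inj₂ {S t} s) ⟨
      isNeg t xor side {S t} {S′ t} (inj₂ s)                 ∎
      where open ≡-Reasoning

    statistic-join : ∀ t y → [ ⨆η η , ⨆η η′ ]′ (join (t , y)) ≡ [ η t , η′ t ]′ y
    statistic-join t (inj₁ s) = cong (uncurry η) (unpair-pair {S = S} (t , s))
    statistic-join t (inj₂ s) = cong (uncurry η′) (unpair-pair {S = S′} (t , s))

    fibrewise : Fibres → Fibres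
    fibrewise (t , y) = t , σ (ψ t) y

    σ⨆ : ∣ ⨆ T S ∣ ⊎ ∣ ⨆ T S′ ∣ → ∣ ⨆ T S ∣ ⊎ ∣ ⨆ T S′ ∣
    σ⨆ = join ∘ fibrewise ∘ split

    σ⨆-involutive : ∀ x → σ⨆ (σ⨆ x) ≡ x
    σ⨆-involutive x = begin
      join (fibrewise (split (join (fibrewise (split x)))))  ≡⟨ cong (join ∘ fibrewise) (split-join _) ⟩
      join (fibrewise (fibrewise (split x)))                  ≡⟨ cong join (twice (split x)) ⟩
      join (split x)                                          ≡⟨ join-split x ⟩
      x                                                       ∎
      where
        open ≡-Reasoning
        twice : ∀ p → fibrewise (fibrewise p) ≡ p
        twice (t , y) = cong (t ,_) (σ-involutive (ψ t) y)

    σ⨆-flips : ∀ x → side {⨆ T S} {⨆ T S′} (σ⨆ x) ≡ not (side {⨆ T S} {⨆ T S′} x)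
    σ⨆-flips x with split x | join-split x
    ... | t , y | refl = begin
      side {⨆ T S} {⨆ T S′} (join (t , σ (ψ t) y))  ≡⟨ side-join t (σ (ψ t) y) ⟩
      isNeg t xor side {S t} {S′ t} (σ (ψ t) y)     ≡⟨ cong (isNeg t xor_) (σ-flips (ψ t) y) ⟩
      isNeg t xor not (side {S t} {S′ t} y)         ≡⟨ not-distribʳ-xor (isNeg t) _ ⟨
      not (isNeg t xor side {S t} {S′ t} y)         ≡⟨ cong not (side-join t y) ⟨
      not (side {⨆ T S} {⨆ T S′} (join (t , y)))    ∎
      where open ≡-Reasoning

    σ⨆-compatible : ∀ x → [ ⨆η η , ⨆η η′ ]′ (σ⨆ x) ≡ [ ⨆η η , ⨆η η′ ]′ x
    σ⨆-compatible x with split x | join-split x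
    ... | t , y | refl = begin
      [ ⨆η η , ⨆η η′ ]′ (join (t , σ (ψ t) y))  ≡⟨ statistic-join t (σ (ψ t) y) ⟩
      [ η t , η′ t ]′ (σ (ψ t) y)               ≡⟨ σ-compatible (ψ t) y ⟩
      [ η t , η′ t ]′ y                         ≡⟨ statistic-join t y ⟨
      [ ⨆η η , ⨆η η′ ]′ (join (t , y))          ∎
      where open ≡-Reasoning

  ⨆-sijection : CompatibleSijection (⨆ T S) (⨆ T S′) (⨆η η) (⨆η η′)
  ⨆-sijection = record
    { σ = σ⨆ ; σ-involutive = σ⨆-involutive ; σ-flips = σ⨆-flips ; σ-compatible = σ⨆-compatible }

  ⨆-forward : (∀ t → Forward (ψ t)) → Forward ⨆-sijection
  ⨆-forward fwd x with fwd (index {T} {S} x) (element {T} {S} x)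
  ... | s′ , e = pair {S = S′} (index {T} {S} x , s′) , cong (λ y → join (index {T} {S} x , y)) e

-- As χ sends its whole source into its target, the alternating chain ψ, χ, ψ, … stops after three steps.
module _ {S T U : SignedSet} {A : Set} {ηS : ∣ S ∣ → A} {ηT : ∣ T ∣ → A} {ηU : ∣ U ∣ → A}
         (ψ : CompatibleSijection S T ηS ηT) (χ : CompatibleSijection T U ηT ηU) (fwd : Forward χ) where

  private
    χ→ : ∣ T ∣ → ∣ U ∣
    χ→ t = proj₁ (fwd t)

    afterψ : ∣ S ∣ ⊎ ∣ T ∣ → ∣ S ∣ ⊎ ∣ U ∣
    afterψ (inj₁ s) = inj₁ s
    afterψ (inj₂ t) = inj₂ (χ→ t)

    afterχ : ∣ T ∣ ⊎ ∣ U ∣ → ∣ S ∣ ⊎ ∣ U ∣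
    afterχ (inj₁ t) = afterψ (σ ψ (inj₂ t))
    afterχ (inj₂ u) = inj₂ u

    σ∘ : ∣ S ∣ ⊎ ∣ U ∣ → ∣ S ∣ ⊎ ∣ U ∣
    σ∘ (inj₁ s) = afterψ (σ ψ (inj₁ s))
    σ∘ (inj₂ u) = afterχ (σ χ (inj₂ u))

    χ→-back : ∀ t → σ χ (inj₂ (χ→ t)) ≡ inj₁ t
    χ→-back t = σ-back χ (proj₂ (fwd t))

    χ→-unique : ∀ {t u} → σ χ (inj₂ u) ≡ inj₁ t → χ→ t ≡ u
    χ→-unique {t} e with trans (sym (proj₂ (fwd t))) (σ-back χ e)
    ... | refl = refl

    sd : ∣ S ∣ ⊎ ∣ U ∣ → Bool
    sd = side {S} {U}

    ηSU : ∣ S ∣ ⊎ ∣ U ∣ → A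
    ηSU = [ ηS , ηU ]′

    σ∘-involutive : ∀ x → σ∘ (σ∘ x) ≡ x
    σ∘-involutive (inj₁ s) with σ ψ (inj₁ s) in e
    ... | inj₁ s′ rewrite σ-back ψ e = refl
    ... | inj₂ t rewrite χ→-back t | σ-back ψ e = refl
    σ∘-involutive (inj₂ u) with σ χ (inj₂ u) in e
    ... | inj₂ u′ rewrite σ-back χ e = refl
    ... | inj₁ t with σ ψ (inj₂ t) in e′
    ...   | inj₁ s rewrite σ-back ψ e′ | χ→-unique e = refl
    ...   | inj₂ t′ rewrite χ→-back t′ | σ-back ψ e′ | χ→-unique e = refl

    σ∘-flips : ∀ x → sd (σ∘ x) ≡ not (sd x)
    σ∘-flips (inj₁ s) with σ ψ (inj₁ s) in e
    ... | inj₁ s′ = begin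
      sd (inj₁ s′)        ≡⟨ side-inj₁ {S} {U} s′ ⟩
      not (isNeg s′)      ≡⟨ cong not (isNeg-withinˡ ψ e) ⟩
      not (not (isNeg s)) ≡⟨ cong not (side-inj₁ {S} {U} s) ⟨
      not (sd (inj₁ s))   ∎
      where open ≡-Reasoning
    ... | inj₂ t = begin
      sd (inj₂ (χ→ t))    ≡⟨ side-inj₂ {S} (χ→ t) ⟩
      isNeg (χ→ t)        ≡⟨ isNeg-across χ (proj₂ (fwd t)) ⟩
      isNeg t             ≡⟨ isNeg-across ψ e ⟩
      isNeg s             ≡⟨ not-involutive (isNeg s) ⟨
      not (not (isNeg s)) ≡⟨ cong not (side-inj₁ {S} {U} s) ⟨
      not (sd (inj₁ s))   ∎
      where open ≡-Reasoning
    σ∘-flips (inj₂ u) with σ χ (inj₂ u) in e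
    ... | inj₂ u′ = trans (side-inj₂ {S} u′) (trans (isNeg-withinʳ χ e) (cong not (sym (side-inj₂ {S} u))))
    ... | inj₁ t with σ ψ (inj₂ t) in e′
    ...   | inj₁ s = begin
      sd (inj₁ s)         ≡⟨ side-inj₁ {S} {U} s ⟩
      not (isNeg s)       ≡⟨ cong not (isNeg-across ψ (σ-back ψ e′)) ⟨
      not (isNeg t)       ≡⟨ cong not (isNeg-across χ (σ-back χ e)) ⟨
      not (isNeg u)       ≡⟨ cong not (side-inj₂ {S} u) ⟨
      not (sd (inj₂ u))   ∎
      where open ≡-Reasoning
    ...   | inj₂ t′ = begin
      sd (inj₂ (χ→ t′))   ≡⟨ side-inj₂ {S} (χ→ t′) ⟩
      isNeg (χ→ t′)       ≡⟨ isNeg-across χ (proj₂ (fwd t′)) ⟩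
      isNeg t′            ≡⟨ isNeg-withinʳ ψ e′ ⟩
      not (isNeg t)       ≡⟨ cong not (isNeg-across χ (σ-back χ e)) ⟨
      not (isNeg u)       ≡⟨ cong not (side-inj₂ {S} u) ⟨
      not (sd (inj₂ u))   ∎
      where open ≡-Reasoning

    σ∘-compatible : ∀ x → ηSU (σ∘ x) ≡ ηSU x
    σ∘-compatible (inj₁ s) with σ ψ (inj₁ s) in e
    ... | inj₁ s′ = σ-statistic ψ e
    ... | inj₂ t = trans (σ-statistic χ (proj₂ (fwd t))) (σ-statistic ψ e)
    σ∘-compatible (inj₂ u) with σ χ (inj₂ u) in e
    ... | inj₂ u′ = σ-statistic χ e
    ... | inj₁ t with σ ψ (inj₂ t) in e′
    ...   | inj₁ s = trans (σ-statistic ψ e′) (σ-statistic χ e)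
    ...   | inj₂ t′ = trans (σ-statistic χ (proj₂ (fwd t′))) (trans (σ-statistic ψ e′) (σ-statistic χ e))

  compose : CompatibleSijection S U ηS ηU
  compose = record
    { σ = σ∘ ; σ-involutive = σ∘-involutive ; σ-flips = σ∘-flips ; σ-compatible = σ∘-compatible }


record SignReversingInvolution (X : SignedSet) (F : Set) {A : Set} (ηX : ∣ X ∣ → A) : Set where
  field
    ι              : ∣ X ∣ → ∣ X ∣ ⊎ F
    embed          : F → ∣ X ∣
    ι-involutive   : ∀ {x y} → ι x ≡ inj₁ y → ι y ≡ inj₁ x
    ι-flips        : ∀ {x y} → ι x ≡ inj₁ y → isNeg y ≡ not (isNeg x)
    ι-compatible   : ∀ {x y} → ι x ≡ inj₁ y → ηX y ≡ ηX x
    ι-fixed        : ∀ {x f} → ι x ≡ inj₂ f → embed f ≡ x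
    ι-embed        : ∀ f → ι (embed f) ≡ inj₂ f
    embed-positive : ∀ f → isNeg (embed f) ≡ false

module _ {X : SignedSet} {F A : Set} {ηX : ∣ X ∣ → A} (ρ : SignReversingInvolution X F ηX)
         (ηF : ∣ F ,ˢ ⊥ ∣ → A) (ηF-embed : ∀ f → ηF (inj₁ f) ≡ ηX (SignReversingInvolution.embed ρ f)) where

  open SignReversingInvolution ρ

  private
    fromι : ∣ X ∣ ⊎ F → ∣ F ,ˢ ⊥ ∣ ⊎ ∣ X ∣
    fromι (inj₁ y) = inj₂ y
    fromι (inj₂ f) = inj₁ (inj₁ f)

    σρ : ∣ F ,ˢ ⊥ ∣ ⊎ ∣ X ∣ → ∣ F ,ˢ ⊥ ∣ ⊎ ∣ X ∣
    σρ (inj₁ (inj₁ f)) = inj₂ (embed f)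
    σρ (inj₂ x)        = fromι (ι x)

    σρ-involutive : ∀ x → σρ (σρ x) ≡ x
    σρ-involutive (inj₁ (inj₁ f)) rewrite ι-embed f = refl
    σρ-involutive (inj₂ x) with ι x in e
    ... | inj₁ y rewrite ι-involutive e = refl
    ... | inj₂ f = cong inj₂ (ι-fixed e)

    σρ-flips : ∀ x → side {F ,ˢ ⊥} {X} (σρ x) ≡ not (side {F ,ˢ ⊥} {X} x)
    σρ-flips (inj₁ (inj₁ f)) = trans (side-inj₂ {F ,ˢ ⊥} (embed f)) (embed-positive f)
    σρ-flips (inj₂ x) with ι x in e
    ... | inj₁ y = trans (side-inj₂ {F ,ˢ ⊥} y) (trans (ι-flips e) (cong not (sym (side-inj₂ {F ,ˢ ⊥} x))))
    ... | inj₂ f rewrite sym (ι-fixed e) | side-inj₂ {F ,ˢ ⊥} (embed f) | embed-positive f = refl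

    σρ-compatible : ∀ x → [ ηF , ηX ]′ (σρ x) ≡ [ ηF , ηX ]′ x
    σρ-compatible (inj₁ (inj₁ f)) = sym (ηF-embed f)
    σρ-compatible (inj₂ x) with ι x in e
    ... | inj₁ y = ι-compatible e
    ... | inj₂ f = trans (ηF-embed f) (cong ηX (ι-fixed e))

  signReversing⇒sijection : CompatibleSijection (F ,ˢ ⊥) X ηF ηX
  signReversing⇒sijection = record
    { σ = σρ ; σ-involutive = σρ-involutive ; σ-flips = σρ-flips ; σ-compatible = σρ-compatible }

-- Arrow vectors and the membership of a row in μ(k)

fromArrow : Arrow → ∣ AR₁ ∣
fromArrow ↖  = inj₁ pos↖
fromArrow ↗  = inj₁ pos↗
fromArrow ↖↗ = inj₂ neg↖↗

arrow-fromArrow : ∀ a → arrow (fromArrow a) ≡ a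
arrow-fromArrow ↖  = refl
arrow-fromArrow ↗  = refl
arrow-fromArrow ↖↗ = refl

fromArrow-arrow : ∀ x → fromArrow (arrow x) ≡ x
fromArrow-arrow (inj₁ pos↖)  = refl
fromArrow-arrow (inj₁ pos↗)  = refl
fromArrow-arrow (inj₂ neg↖↗) = refl

fromArrows : ∀ N → Vec Arrow N → ∣ AR N ∣
fromArrows zero    []       = inj₁ tt
fromArrows (suc N) (a ∷ as) = _,×_ {AR₁} {AR N} (fromArrow a) (fromArrows N as)

arrows-fromArrows : ∀ N (α : Vec Arrow N) → arrows N (fromArrows N α) ≡ α
arrows-fromArrows zero    []       = refl
arrows-fromArrows (suc N) (a ∷ as)
  rewrite π₁-,× {AR₁} {AR N} (fromArrow a) (fromArrows N as)
        | π₂-,× {AR₁} {AR N} (fromArrow a) (fromArrows N as)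
        | arrow-fromArrow a | arrows-fromArrows N as = refl

fromArrows-arrows : ∀ N (μ : ∣ AR N ∣) → fromArrows N (arrows N μ) ≡ μ
fromArrows-arrows zero    (inj₁ tt) = refl
fromArrows-arrows (suc N) μ
  rewrite fromArrow-arrow (π₁ {AR₁} {AR N} μ) | fromArrows-arrows N (π₂ {AR₁} {AR N} μ) = π₁,π₂ {AR₁} {AR N} μ

isNegArrow : Arrow → Bool
isNegArrow ↖↗ = true
isNegArrow _  = false

parity : ∀ {N} → Vec Arrow N → Bool
parity []       = false
parity (a ∷ as) = isNegArrow a xor parity as

isNeg-AR₁ : ∀ x → isNeg {AR₁} x ≡ isNegArrow (arrow x)
isNeg-AR₁ (inj₁ pos↖)  = refl
isNeg-AR₁ (inj₁ pos↗)  = refl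
isNeg-AR₁ (inj₂ neg↖↗) = refl

isNeg-AR : ∀ N (μ : ∣ AR N ∣) → isNeg {AR N} μ ≡ parity (arrows N μ)
isNeg-AR zero    (inj₁ tt) = refl
isNeg-AR (suc N) μ
  rewrite isNeg-π {AR₁} {AR N} μ | isNeg-AR₁ (π₁ {AR₁} {AR N} μ) | isNeg-AR N (π₂ {AR₁} {AR N} μ) = refl

has↗ : Arrow → Bool
has↗ ↖  = false
has↗ ↗  = true
has↗ ↖↗ = true

has↖ : Arrow → Bool
has↖ ↖  = true
has↖ ↗  = false
has↖ ↖↗ = true

positiveUnless : Bool → Maybe Bool
positiveUnless true  = nothing
positiveUnless false = just false

-- For k ≤ l < k′, with L = (l ≡ k) and R = (l + 1 ≡ k′): is l an element of the signed
-- interval [k + d, k′ − e), and if so, is it a negative one?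
membership : (d e L R : Bool) → Maybe Bool
membership false false _     _     = just false
membership true  false L     _     = positiveUnless L
membership false true  _     R     = positiveUnless R
membership true  true  true  true  = just true
membership true  true  true  false = nothing
membership true  true  false true  = nothing
membership true  true  false false = just false

membership-↖-irrelevant : ∀ d e e′ L → membership d e L false ≡ membership d e′ L false
membership-↖-irrelevant false false false L     = refl
membership-↖-irrelevant false false true  L     = refl
membership-↖-irrelevant false true  false L     = refl
membership-↖-irrelevant false true  true  L     = refl
membership-↖-irrelevant true  false false L     = refl
membership-↖-irrelevant true  false true  false = refl
membership-↖-irrelevant true  false true  true  = refl
membership-↖-irrelevant true  true  false false = refl
membership-↖-irrelevant true  true  false true  = refl
membership-↖-irrelevant true  true  true  L     = refl

membership-↗-irrelevant : ∀ d d′ e R → membership d e false R ≡ membership d′ e false R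
membership-↗-irrelevant false false e     R     = refl
membership-↗-irrelevant true  true  e     R     = refl
membership-↗-irrelevant false true  false R     = refl
membership-↗-irrelevant false true  true  false = refl
membership-↗-irrelevant false true  true  true  = refl
membership-↗-irrelevant true  false false R     = refl
membership-↗-irrelevant true  false true  false = refl
membership-↗-irrelevant true  false true  true  = refl

rowMembership : ∀ {m} → Vec Arrow (suc m) → Vec Bool m → Vec Bool m → Maybe Bool
rowMembership (a ∷ [])     []       []       = just false
rowMembership (a ∷ b ∷ as) (L ∷ Ls) (R ∷ Rs) =
  zipWith _xor_ (membership (has↗ a) (has↖ b) L R) (rowMembership (b ∷ as) Ls Rs)

-- The arrow at k_j may toggle its ↖ part unless k_j is pinched from the left (l_{j-1} + 1 = k_j),
-- and its ↗ part unless l_j = k_j; by the two lemmas above, membership does not notice either.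
toggle : (pinched atLower : Bool) → Arrow → Maybe Arrow
toggle false _     ↖  = nothing
toggle false _     ↗  = just ↖↗
toggle false _     ↖↗ = just ↗
toggle true  false ↖  = just ↖↗
toggle true  false ↗  = nothing
toggle true  false ↖↗ = just ↖
toggle true  true  _  = nothing

switch : ∀ {m} → Bool → Vec Arrow (suc m) → Vec Bool m → Vec Bool m → Maybe (Vec Arrow (suc m))
switch p (a ∷ [])     []       []       = Maybe.map (_∷ []) (toggle p false a)
switch p (a ∷ b ∷ as) (L ∷ Ls) (R ∷ Rs) =
  Maybe.map (_∷ b ∷ as) (toggle p L a) <∣> Maybe.map (a ∷_) (switch R (b ∷ as) Ls Rs)

canonicalArrow : Bool → Arrow
canonicalArrow false = ↖
canonicalArrow true  = ↗

canonical : ∀ {m} → Bool → Vec Bool m → Vec Bool m → Vec Arrow (suc m)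
canonical p []       []       = canonicalArrow p ∷ []
canonical p (L ∷ Ls) (R ∷ Rs) = canonicalArrow p ∷ canonical R Ls Rs

Unpinched : ∀ {m} → Bool → Vec Bool m → Vec Bool m → Set
Unpinched p []       []       = ⊤
Unpinched p (L ∷ Ls) (R ∷ Rs) = (p ≡ true → L ≡ false) × Unpinched R Ls Rs

firstBit : ∀ {m} → Vec Bool m → Bool
firstBit []      = false
firstBit (L ∷ _) = L

NoDoublePinch : ∀ {m} → Bool → Vec Bool m → Vec Bool m → Set
NoDoublePinch p []       []       = ⊤
NoDoublePinch p (L ∷ Ls) (R ∷ Rs) =
  (p ≡ true → L ≡ true → R ≡ true → firstBit Ls ≡ false) × NoDoublePinch R Ls Rs

toggle-involutive : ∀ {p L a a′} → toggle p L a ≡ just a′ → toggle p L a′ ≡ just a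
toggle-involutive {false} {_}     {↗}  refl = refl
toggle-involutive {false} {_}     {↖↗} refl = refl
toggle-involutive {true}  {false} {↖}  refl = refl
toggle-involutive {true}  {false} {↖↗} refl = refl

toggle-flips : ∀ {p L a a′} → toggle p L a ≡ just a′ → isNegArrow a′ ≡ not (isNegArrow a)
toggle-flips {false} {_}     {↗}  refl = refl
toggle-flips {false} {_}     {↖↗} refl = refl
toggle-flips {true}  {false} {↖}  refl = refl
toggle-flips {true}  {false} {↖↗} refl = refl

toggle-keeps-↖ : ∀ {L a a′} → toggle true L a ≡ just a′ → has↖ a′ ≡ has↖ a
toggle-keeps-↖ {false} {↖}  refl = refl
toggle-keeps-↖ {false} {↖↗} refl = refl

toggle-membership : ∀ {p L a a′} e R → toggle p L a ≡ just a′ →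
  membership (has↗ a′) e L R ≡ membership (has↗ a) e L R
toggle-membership {false} {_}     {↗}  e R refl = refl
toggle-membership {false} {_}     {↖↗} e R refl = refl
toggle-membership {true}  {false} {↖}  e R refl = membership-↗-irrelevant true false e R
toggle-membership {true}  {false} {↖↗} e R refl = membership-↗-irrelevant false true e R

toggle-canonical : ∀ p L → toggle p L (canonicalArrow p) ≡ nothing
toggle-canonical false _     = refl
toggle-canonical true  false = refl
toggle-canonical true  true  = refl

switch-involutive : ∀ {m} p (α α′ : Vec Arrow (suc m)) Ls Rs →
  switch p α Ls Rs ≡ just α′ → switch p α′ Ls Rs ≡ just α
switch-involutive p (a ∷ []) α′ [] [] h with toggle p false a in e
switch-involutive p (a ∷ []) .(a′ ∷ []) [] [] refl | just a′ rewrite toggle-involutive e = refl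
switch-involutive p (a ∷ b ∷ as) α′ (L ∷ Ls) (R ∷ Rs) h with toggle p L a in e
switch-involutive p (a ∷ b ∷ as) .(a′ ∷ b ∷ as) (L ∷ Ls) (R ∷ Rs) refl | just a′
  rewrite toggle-involutive e = refl
... | nothing with switch R (b ∷ as) Ls Rs in e′
switch-involutive p (a ∷ b ∷ as) .(a ∷ b′ ∷ bs′) (L ∷ Ls) (R ∷ Rs) refl | nothing | just (b′ ∷ bs′)
  rewrite e | switch-involutive R (b ∷ as) (b′ ∷ bs′) Ls Rs e′ = refl

switch-flips : ∀ {m} p (α α′ : Vec Arrow (suc m)) Ls Rs →
  switch p α Ls Rs ≡ just α′ → parity α′ ≡ not (parity α)
switch-flips p (a ∷ []) α′ [] [] h with toggle p false a in e
switch-flips p (a ∷ []) .(a′ ∷ []) [] [] refl | just a′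
  rewrite toggle-flips e = sym (not-distribˡ-xor (isNegArrow a) false)
switch-flips p (a ∷ b ∷ as) α′ (L ∷ Ls) (R ∷ Rs) h with toggle p L a in e
switch-flips p (a ∷ b ∷ as) .(a′ ∷ b ∷ as) (L ∷ Ls) (R ∷ Rs) refl | just a′
  rewrite toggle-flips e = sym (not-distribˡ-xor (isNegArrow a) _)
... | nothing with switch R (b ∷ as) Ls Rs in e′
switch-flips p (a ∷ b ∷ as) .(a ∷ β) (L ∷ Ls) (R ∷ Rs) refl | nothing | just β
  rewrite switch-flips R (b ∷ as) β Ls Rs e′ = sym (not-distribʳ-xor (isNegArrow a) _)

switch-keeps-↖ : ∀ {m} b (as : Vec Arrow m) b′ bs′ Ls Rs →
  switch true (b ∷ as) Ls Rs ≡ just (b′ ∷ bs′) → has↖ b′ ≡ has↖ b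
switch-keeps-↖ b [] b′ bs′ [] [] h with toggle true false b in e
switch-keeps-↖ b [] b′ .[] [] [] refl | just _ = toggle-keeps-↖ e
switch-keeps-↖ b (c ∷ cs) b′ bs′ (L ∷ Ls) (R ∷ Rs) h with toggle true L b in e
switch-keeps-↖ b (c ∷ cs) b′ .(c ∷ cs) (L ∷ Ls) (R ∷ Rs) refl | just _ = toggle-keeps-↖ e
... | nothing with switch R (c ∷ cs) Ls Rs
switch-keeps-↖ b (c ∷ cs) .b _ (L ∷ Ls) (R ∷ Rs) refl | nothing | just _ = refl

switch-membership : ∀ {m} p (α α′ : Vec Arrow (suc m)) Ls Rs →
  switch p α Ls Rs ≡ just α′ → rowMembership α′ Ls Rs ≡ rowMembership α Ls Rs
switch-membership p (a ∷ []) α′ [] [] h with toggle p false a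
switch-membership p (a ∷ []) .(a′ ∷ []) [] [] refl | just a′ = refl
switch-membership p (a ∷ b ∷ as) α′ (L ∷ Ls) (R ∷ Rs) h with toggle p L a in e
switch-membership p (a ∷ b ∷ as) .(a′ ∷ b ∷ as) (L ∷ Ls) (R ∷ Rs) refl | just a′
  rewrite toggle-membership (has↖ b) R e = refl
... | nothing with switch R (b ∷ as) Ls Rs in e′
switch-membership p (a ∷ b ∷ as) .(a ∷ b′ ∷ bs′) (L ∷ Ls) (R ∷ Rs) refl | nothing | just (b′ ∷ bs′)
  rewrite switch-membership R (b ∷ as) (b′ ∷ bs′) Ls Rs e′ =
    cong (λ m → zipWith _xor_ m (rowMembership (b ∷ as) Ls Rs)) (headMembership R e′)
  where
    headMembership : ∀ R → switch R (b ∷ as) Ls Rs ≡ just (b′ ∷ bs′) →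
      membership (has↗ a) (has↖ b′) L R ≡ membership (has↗ a) (has↖ b) L R
    headMembership true  e″ rewrite switch-keeps-↖ b as b′ bs′ Ls Rs e″ = refl
    headMembership false _  = membership-↖-irrelevant (has↗ a) (has↖ b′) (has↖ b) L

switch-canonical : ∀ {m} p (Ls Rs : Vec Bool m) → switch p (canonical p Ls Rs) Ls Rs ≡ nothing
switch-canonical p [] [] rewrite toggle-canonical p false = refl
switch-canonical p (L ∷ []) (R ∷ []) =
  cong₂ (λ x y → Maybe.map (_∷ canonical R [] []) x <∣> Maybe.map (canonicalArrow p ∷_) y)
        (toggle-canonical p L) (switch-canonical R [] [])
switch-canonical p (L ∷ L′ ∷ Ls) (R ∷ R′ ∷ Rs) =
  cong₂ (λ x y → Maybe.map (_∷ canonical R (L′ ∷ Ls) (R′ ∷ Rs)) x <∣> Maybe.map (canonicalArrow p ∷_) y)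
        (toggle-canonical p L) (switch-canonical R (L′ ∷ Ls) (R′ ∷ Rs))

canonical-parity : ∀ {m} p (Ls Rs : Vec Bool m) → parity (canonical p Ls Rs) ≡ false
canonical-parity false []       []       = refl
canonical-parity true  []       []       = refl
canonical-parity false (L ∷ Ls) (R ∷ Rs) = canonical-parity R Ls Rs
canonical-parity true  (L ∷ Ls) (R ∷ Rs) = canonical-parity R Ls Rs

canonical-entry : ∀ p L R → (p ≡ true → L ≡ false) →
  membership (has↗ (canonicalArrow p)) (has↖ (canonicalArrow R)) L R ≡ just false
canonical-entry false L     false _ = refl
canonical-entry false L     true  _ = refl
canonical-entry true  false false _ = refl
canonical-entry true  false true  _ = refl
canonical-entry true  true  R     h with h refl
... | ()

canonical-membership : ∀ {m} p (Ls Rs : Vec Bool m) → Unpinched p Ls Rs →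
  rowMembership (canonical p Ls Rs) Ls Rs ≡ just false
canonical-membership p [] [] _ = refl
canonical-membership p (L ∷ []) (R ∷ []) (h , _) =
  cong (λ x → zipWith _xor_ x (just false)) (canonical-entry p L R h)
canonical-membership p (L ∷ L′ ∷ Ls) (R ∷ R′ ∷ Rs) (h , hs) =
  cong₂ (zipWith _xor_) (canonical-entry p L R h) (canonical-membership R (L′ ∷ Ls) (R′ ∷ Rs) hs)

zipWith-just : {A B C : Set} {f : A → B → C} (x : Maybe A) (y : Maybe B) {c : C} →
  zipWith f x y ≡ just c → ∃[ a ] ∃[ b ] x ≡ just a × y ≡ just b
zipWith-just (just a) (just b) _ = a , b , refl , refl

fixed⇒canonicalArrow : ∀ {p L} a → toggle p L a ≡ nothing → (p ≡ true → has↖ a ≡ false) →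
  a ≡ canonicalArrow p
fixed⇒canonicalArrow {false} ↖ _ _ = refl
fixed⇒canonicalArrow {true}  ↗ _ _ = refl
fixed⇒canonicalArrow {true}  ↖ _ h with h refl
... | ()
fixed⇒canonicalArrow {true}  ↖↗ _ h with h refl
... | ()

switch-fixed-head : ∀ {m} p b (as : Vec Arrow m) Ls Rs →
  switch p (b ∷ as) Ls Rs ≡ nothing → toggle p (firstBit Ls) b ≡ nothing
switch-fixed-head p b [] [] [] h with toggle p false b
... | nothing = refl
switch-fixed-head p b (c ∷ cs) (L ∷ Ls) (R ∷ Rs) h with toggle p L b
... | nothing = refl

unpinched-entry : ∀ p {L R b L′ s} → membership (has↗ (canonicalArrow p)) (has↖ b) L R ≡ just s →
  (p ≡ true → L ≡ true → R ≡ true → L′ ≡ false) → toggle R L′ b ≡ nothing → p ≡ true → L ≡ false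
unpinched-entry true {false} _ _ _ _ = refl
unpinched-entry true {true} {true} {↖} _ h t _ with h refl refl refl | t
... | refl | ()
unpinched-entry true {true} {true} {↖↗} _ h t _ with h refl refl refl | t
... | refl | ()

pinched⇒no↖ : ∀ p {L R e s} → membership (has↗ (canonicalArrow p)) e L R ≡ just s →
  (p ≡ true → L ≡ false) → R ≡ true → e ≡ false
pinched⇒no↖ false {e = false} _ _ _ = refl
pinched⇒no↖ false {e = true} () _ refl
pinched⇒no↖ true {false} {e = false} _ _ _ = refl
pinched⇒no↖ true {false} {e = true} () _ refl
pinched⇒no↖ true {true} _ h _ with h refl
... | ()

switch-fixed⇒canonical : ∀ {m} p (α : Vec Arrow (suc m)) Ls Rs {s} →
  switch p α Ls Rs ≡ nothing → rowMembership α Ls Rs ≡ just s →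
  (p ≡ true → has↖ (head α) ≡ false) → NoDoublePinch p Ls Rs →
  Unpinched p Ls Rs × α ≡ canonical p Ls Rs
switch-fixed⇒canonical p (a ∷ []) [] [] fixed _ h _ =
  tt , cong (_∷ []) (fixed⇒canonicalArrow a (switch-fixed-head p a [] [] [] fixed) h)
switch-fixed⇒canonical p (a ∷ b ∷ as) (L ∷ Ls) (R ∷ Rs) fixed member h (noDouble , noDoubles)
  with toggle p L a in e | switch R (b ∷ as) Ls Rs in e′
     | zipWith-just (membership (has↗ a) (has↖ b) L R) (rowMembership (b ∷ as) Ls Rs) member
... | nothing | nothing | _ , _ , entry , rest with fixed⇒canonicalArrow a e h
...   | refl = (unpinched , proj₁ ih) , cong (canonicalArrow p ∷_) (proj₂ ih)
  where
    unpinched : p ≡ true → L ≡ false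
    unpinched = unpinched-entry p entry noDouble (switch-fixed-head R b as Ls Rs e′)
    ih = switch-fixed⇒canonical R (b ∷ as) Ls Rs e′ rest (pinched⇒no↖ p entry unpinched) noDoubles

-- Signed intervals

_=ᵇ_ : ℤ → ℤ → Bool
x =ᵇ y = does (x ℤ.≟ y)

valueOf : ∀ {a b} → ∣ [ a , b ⟩ ∣ → ℤ
valueOf (inj₁ (x , _)) = x
valueOf (inj₂ (x , _)) = x

raise : Bool → ℤ → ℤ
raise true  k = sucℤ k
raise false k = k

lower : Bool → ℤ → ℤ
lower true  k = pred k
lower false k = k

+δ↗ : ∀ k a → k + δ↗ a ≡ raise (has↗ a) k
+δ↗ k ↖  = ℤ.+-identityʳ k
+δ↗ k ↗  = ℤ.+-comm k 1ℤ
+δ↗ k ↖↗ = ℤ.+-comm k 1ℤ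

-δ↖ : ∀ k a → k - δ↖ a ≡ lower (has↖ a) k
-δ↖ k ↖  = ℤ.+-comm k ℤ.-1ℤ
-δ↖ k ↗  = ℤ.+-identityʳ k
-δ↖ k ↖↗ = ℤ.+-comm k ℤ.-1ℤ

k≤raise : ∀ d k → k ≤ raise d k
k≤raise true  k = ℤ.i≤suc[i] k
k≤raise false k = ℤ.≤-refl

raise≤suc : ∀ d k → raise d k ≤ sucℤ k
raise≤suc true  k = ℤ.≤-refl
raise≤suc false k = ℤ.i≤suc[i] k

lower≤k : ∀ e k → lower e k ≤ k
lower≤k true  k = ℤ.i≤j⇒pred[i]≤j ℤ.≤-refl
lower≤k false k = ℤ.≤-refl

pred≤lower : ∀ e k → pred k ≤ lower e k
pred≤lower true  k = ℤ.≤-refl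
pred≤lower false k = ℤ.i≤j⇒pred[i]≤j ℤ.≤-refl

suc≤⇒≢ : ∀ {k x} → sucℤ k ≤ x → x ≢ k
suc≤⇒≢ p refl = ℤ.<-irrefl refl (ℤ.suc[i]≤j⇒i<j p)

<pred⇒suc≢ : ∀ {k x} → x < pred k → sucℤ x ≢ k
<pred⇒suc≢ {x = x} p refl = ℤ.<-irrefl refl (subst (x <_) (ℤ.pred-suc x) p)

≤∧≢⇒suc≤ : ∀ {k x} → k ≤ x → x ≢ k → sucℤ k ≤ x
≤∧≢⇒suc≤ k≤x x≢k = ℤ.i<j⇒suc[i]≤j (ℤ.≤∧≢⇒< k≤x (x≢k ∘ sym))

<∧suc≢⇒<pred : ∀ {k x} → x < k → sucℤ x ≢ k → x < pred k
<∧suc≢⇒<pred x<k sx≢k =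
  ℤ.suc[i]≤j⇒i<j (ℤ.i<j⇒i≤pred[j] (ℤ.≤∧≢⇒< (ℤ.i<j⇒suc[i]≤j x<k) sx≢k))

≤∧<suc⇒≡ : ∀ {k x} → k ≤ x → x < sucℤ k → x ≡ k
≤∧<suc⇒≡ {k} {x} k≤x x<sk = ℤ.≤-antisym (subst (x ℤ.≤_) (ℤ.pred-suc k) (ℤ.i<j⇒i≤pred[j] x<sk)) k≤x

pred≤∧<⇒suc≡ : ∀ {k x} → pred k ≤ x → x < k → sucℤ x ≡ k
pred≤∧<⇒suc≡ {k} pk≤x x<k = ℤ.≤-antisym (ℤ.i<j⇒suc[i]≤j x<k) (subst (_≤ _) (ℤ.suc-pred k) (ℤ.suc-mono pk≤x))

module _ {k₁ k₂ : ℤ} (k₁<k₂ : k₁ < k₂) where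

  interval-bounds : ∀ d e (u : ∣ [ raise d k₁ , lower e k₂ ⟩ ∣) → k₁ ≤ valueOf u × valueOf u < k₂
  interval-bounds d e (inj₁ (x , lo≤x , x<hi)) =
    ℤ.≤-trans (k≤raise d k₁) lo≤x , ℤ.<-≤-trans x<hi (lower≤k e k₂)
  interval-bounds d e (inj₂ (x , hi≤x , x<lo)) =
    ℤ.≤-trans (ℤ.i<j⇒i≤pred[j] k₁<k₂) (ℤ.≤-trans (pred≤lower e k₂) hi≤x) ,
    ℤ.<-≤-trans x<lo (ℤ.≤-trans (raise≤suc d k₁) (ℤ.i<j⇒suc[i]≤j k₁<k₂))

  -- As k₁ < k₂, the interval has negative elements only if d = e = true and k₂ = k₁ + 1,
  -- and then it is the single negative element k₁.
  membership-value : ∀ d e (u : ∣ [ raise d k₁ , lower e k₂ ⟩ ∣) →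
    membership d e (valueOf u =ᵇ k₁) (sucℤ (valueOf u) =ᵇ k₂) ≡ just (isNeg u)
  membership-value false false (inj₁ _) = refl
  membership-value true  false (inj₁ (x , p , _))
    rewrite dec-false (x ℤ.≟ k₁) (suc≤⇒≢ p) = refl
  membership-value false true  (inj₁ (x , _ , q))
    rewrite dec-false (sucℤ x ℤ.≟ k₂) (<pred⇒suc≢ q) = refl
  membership-value true  true  (inj₁ (x , p , q))
    rewrite dec-false (x ℤ.≟ k₁) (suc≤⇒≢ p) | dec-false (sucℤ x ℤ.≟ k₂) (<pred⇒suc≢ q) = refl
  membership-value false e (inj₂ u@(x , _ , x<k₁)) =
    ⊥-elim (ℤ.<-irrefl refl (ℤ.<-≤-trans x<k₁ (proj₁ (interval-bounds false e (inj₂ u)))))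
  membership-value true false (inj₂ u@(x , k₂≤x , _)) =
    ⊥-elim (ℤ.<-irrefl refl (ℤ.<-≤-trans (proj₂ (interval-bounds true false (inj₂ u))) k₂≤x))
  membership-value true true (inj₂ u@(x , p , q))
    rewrite dec-true (x ℤ.≟ k₁) (≤∧<suc⇒≡ (proj₁ (interval-bounds true true (inj₂ u))) q)
          | dec-true (sucℤ x ℤ.≟ k₂) (pred≤∧<⇒suc≡ p (proj₂ (interval-bounds true true (inj₂ u)))) = refl

membership-witness : ∀ d e {k₁ k₂ x s} → k₁ ≤ x → x < k₂ →
  membership d e (x =ᵇ k₁) (sucℤ x =ᵇ k₂) ≡ just s →
  Σ ∣ [ raise d k₁ , lower e k₂ ⟩ ∣ (λ u → valueOf u ≡ x × isNeg u ≡ s)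
membership-witness d e {k₁} {k₂} {x} k₁≤x x<k₂ h with x ℤ.≟ k₁ | sucℤ x ℤ.≟ k₂
membership-witness false false k₁≤x x<k₂ refl | _ | _ = inj₁ (_ , k₁≤x , x<k₂) , refl , refl
membership-witness true  false k₁≤x x<k₂ refl | no x≢k₁ | _ =
  inj₁ (_ , ≤∧≢⇒suc≤ k₁≤x x≢k₁ , x<k₂) , refl , refl
membership-witness false true  k₁≤x x<k₂ refl | _ | no sx≢k₂ =
  inj₁ (_ , k₁≤x , <∧suc≢⇒<pred x<k₂ sx≢k₂) , refl , refl
membership-witness true  true  k₁≤x x<k₂ refl | no x≢k₁ | no sx≢k₂ =
  inj₁ (_ , ≤∧≢⇒suc≤ k₁≤x x≢k₁ , <∧suc≢⇒<pred x<k₂ sx≢k₂) , refl , refl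
membership-witness true  true  {x = x} _ _ refl | yes refl | yes refl =
  inj₂ (x , ℤ.≤-reflexive (ℤ.pred-suc x) , ℤ.suc[i]≤j⇒i<j ℤ.≤-refl) , refl , refl

interval-unique : ∀ {a b} (u u′ : ∣ [ a , b ⟩ ∣) → valueOf u ≡ valueOf u′ → u ≡ u′
interval-unique (inj₁ (x , p , q)) (inj₁ (.x , p′ , q′)) refl
  rewrite ℤ.≤-irrelevant p p′ | ℤ.<-irrelevant q q′ = refl
interval-unique (inj₂ (x , p , q)) (inj₂ (.x , p′ , q′)) refl
  rewrite ℤ.≤-irrelevant p p′ | ℤ.<-irrelevant q q′ = refl
interval-unique (inj₁ (x , p , q)) (inj₂ (.x , p′ , q′)) refl =
  ⊥-elim (ℤ.<-irrefl refl (ℤ.≤-<-trans p (ℤ.<-≤-trans q (ℤ.≤-trans p′ (ℤ.<⇒≤ q′)))))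
interval-unique (inj₂ (x , p , q)) (inj₁ (.x , p′ , q′)) refl =
  ⊥-elim (ℤ.<-irrefl refl (ℤ.≤-<-trans p (ℤ.<-≤-trans q (ℤ.≤-trans p′ (ℤ.<⇒≤ q′)))))

module _ (a b : Arrow) {k₁ k₂ : ℤ} where

  private
    Entry : Set
    Entry = ∣ [ k₁ + δ↗ a , k₂ - δ↖ b ⟩ ∣

    normalise : ∀ (P : ℤ → ℤ → Set) → P (raise (has↗ a) k₁) (lower (has↖ b) k₂) → P (k₁ + δ↗ a) (k₂ - δ↖ b)
    normalise P = subst₂ P (sym (+δ↗ k₁ a)) (sym (-δ↖ k₂ b))

  entry-bounds : k₁ < k₂ → (u : Entry) → k₁ ≤ valueOf u × valueOf u < k₂
  entry-bounds lt = normalise (λ lo hi → (u : ∣ [ lo , hi ⟩ ∣) → k₁ ≤ valueOf u × valueOf u < k₂)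
                              (interval-bounds lt (has↗ a) (has↖ b))

  entry-membership : k₁ < k₂ → (u : Entry) →
    membership (has↗ a) (has↖ b) (valueOf u =ᵇ k₁) (sucℤ (valueOf u) =ᵇ k₂) ≡ just (isNeg u)
  entry-membership lt = normalise
    (λ lo hi → (u : ∣ [ lo , hi ⟩ ∣) →
       membership (has↗ a) (has↖ b) (valueOf u =ᵇ k₁) (sucℤ (valueOf u) =ᵇ k₂) ≡ just (isNeg u))
    (membership-value lt (has↗ a) (has↖ b))

  entry-witness : ∀ {x s} → k₁ ≤ x → x < k₂ → membership (has↗ a) (has↖ b) (x =ᵇ k₁) (sucℤ x =ᵇ k₂) ≡ just s →
    Σ Entry (λ u → valueOf u ≡ x × isNeg u ≡ s)
  entry-witness {x} {s} p q h = normalise (λ lo hi → Σ ∣ [ lo , hi ⟩ ∣ (λ u → valueOf u ≡ x × isNeg u ≡ s))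
                                          (membership-witness (has↗ a) (has↖ b) p q h)

×-elim : {S T : SignedSet} (P : ∣ S ×ˢ T ∣ → Set) → (∀ s t → P (_,×_ {S} {T} s t)) → ∀ x → P x
×-elim {S} {T} P h x = subst P (π₁,π₂ {S} {T} x) (h _ _)

values-,× : ∀ {m} a b (as bs : Vec ℤ m) (u : ∣ [ a , b ⟩ ∣) (r : ∣ IProd as bs ∣) →
  values (a ∷ as) (b ∷ bs) (_,×_ {[ a , b ⟩} {IProd as bs} u r) ≡ valueOf u ∷ values as bs r
values-,× a b as bs (inj₁ _) (inj₁ _) = refl
values-,× a b as bs (inj₁ _) (inj₂ _) = refl
values-,× a b as bs (inj₂ _) (inj₁ _) = refl
values-,× a b as bs (inj₂ _) (inj₂ _) = refl

values-unique : ∀ {m} (as bs : Vec ℤ m) (x y : ∣ IProd as bs ∣) → values as bs x ≡ values as bs y → x ≡ y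
values-unique []       []       (inj₁ tt) (inj₁ tt) _ = refl
values-unique (a ∷ as) (b ∷ bs) x y e = begin
  x                                  ≡⟨ π₁,π₂ {I} {P} x ⟨
  _,×_ {I} {P} (π₁ {I} {P} x) (π₂ {I} {P} x)
    ≡⟨ cong₂ (_,×_ {I} {P}) (interval-unique _ _ (∷-injectiveˡ e′)) (values-unique as bs _ _ (∷-injectiveʳ e′)) ⟩
  _,×_ {I} {P} (π₁ {I} {P} y) (π₂ {I} {P} y)  ≡⟨ π₁,π₂ {I} {P} y ⟩
  y                                  ∎
  where
    open ≡-Reasoning
    I : SignedSet
    I = [ a , b ⟩
    P : SignedSet
    P = IProd as bs
    unfold : ∀ z → values (a ∷ as) (b ∷ bs) z ≡ valueOf (π₁ {I} {P} z) ∷ values as bs (π₂ {I} {P} z)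
    unfold z = trans (cong (values (a ∷ as) (b ∷ bs)) (sym (π₁,π₂ {I} {P} z)))
                     (values-,× a b as bs (π₁ {I} {P} z) (π₂ {I} {P} z))
    e′ = trans (sym (unfold x)) (trans e (unfold y))

atLower : ∀ {m} → Vec ℤ (suc m) → Vec ℤ m → Vec Bool m
atLower (k₁ ∷ [])      []       = []
atLower (k₁ ∷ k₂ ∷ ks) (x ∷ ls) = (x =ᵇ k₁) ∷ atLower (k₂ ∷ ks) ls

atUpper : ∀ {m} → Vec ℤ (suc m) → Vec ℤ m → Vec Bool m
atUpper (k₁ ∷ [])      []       = []
atUpper (k₁ ∷ k₂ ∷ ks) (x ∷ ls) = (sucℤ x =ᵇ k₂) ∷ atUpper (k₂ ∷ ks) ls

rowOf : ∀ {m} (α : Vec Arrow (suc m)) (k : Vec ℤ (suc m)) → ∣ μ⟨ α ⟩ k ∣ → Vec ℤ m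
rowOf α k = values (lowers α k) (uppers α k)

rowOf-membership : ∀ {m} (k : Vec ℤ (suc m)) α → StrictlyIncreasing k → (lv : ∣ μ⟨ α ⟩ k ∣) →
  rowMembership α (atLower k (rowOf α k lv)) (atUpper k (rowOf α k lv)) ≡ just (isNeg lv)
  × Interlace (rowOf α k lv) k
rowOf-membership (k₁ ∷ [])      (a ∷ [])     _             (inj₁ tt) = refl , tt
rowOf-membership {suc m} (k₁ ∷ k₂ ∷ ks) (a ∷ b ∷ as) (k₁<k₂ , inc) = ×-elim {I} {R} Holds cons
  where
    I : SignedSet
    I = [ k₁ + δ↗ a , k₂ - δ↖ b ⟩
    R : SignedSet
    R = μ⟨ b ∷ as ⟩ (k₂ ∷ ks)
    Claim : ∣ I ×ˢ R ∣ → Vec ℤ (suc m) → Set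
    Claim lv l = rowMembership (a ∷ b ∷ as) (atLower (k₁ ∷ k₂ ∷ ks) l) (atUpper (k₁ ∷ k₂ ∷ ks) l)
                 ≡ just (isNeg lv) × Interlace l (k₁ ∷ k₂ ∷ ks)
    Holds : ∣ I ×ˢ R ∣ → Set
    Holds lv = Claim lv (rowOf (a ∷ b ∷ as) (k₁ ∷ k₂ ∷ ks) lv)
    cons : ∀ u r → Holds (_,×_ {I} {R} u r)
    cons u r = subst (Claim (_,×_ {I} {R} u r))
      (sym (values-,× (k₁ + δ↗ a) (k₂ - δ↖ b) (lowers (b ∷ as) (k₂ ∷ ks)) (uppers (b ∷ as) (k₂ ∷ ks)) u r))
      (trans (cong₂ (zipWith _xor_) (entry-membership a b k₁<k₂ u) (proj₁ ih)) (cong just (sym (isNeg-,× u r))) ,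
       proj₁ bounds , proj₂ bounds , proj₂ ih)
      where
        ih = rowOf-membership (k₂ ∷ ks) (b ∷ as) inc r
        bounds = entry-bounds a b k₁<k₂ u

rowOf-witness : ∀ {m} (k : Vec ℤ (suc m)) α (l : Vec ℤ m) {s} → Interlace l k →
  rowMembership α (atLower k l) (atUpper k l) ≡ just s →
  Σ ∣ μ⟨ α ⟩ k ∣ (λ lv → rowOf α k lv ≡ l × isNeg lv ≡ s)
rowOf-witness (k₁ ∷ []) (a ∷ []) [] tt refl = inj₁ tt , refl , refl
rowOf-witness (k₁ ∷ k₂ ∷ ks) (a ∷ b ∷ as) (x ∷ ls) {s} (k₁≤x , x<k₂ , il) member
  with zipWith-just _ _ member
... | s₁ , s₂ , entry , rest =
  _,×_ {I} {R} (proj₁ U) (proj₁ V) ,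
  trans (values-,× (k₁ + δ↗ a) (k₂ - δ↖ b) (lowers (b ∷ as) (k₂ ∷ ks)) (uppers (b ∷ as) (k₂ ∷ ks)) (proj₁ U) (proj₁ V))
        (cong₂ _∷_ (proj₁ (proj₂ U)) (proj₁ (proj₂ V))) ,
  trans (isNeg-,× (proj₁ U) (proj₁ V))
        (trans (cong₂ _xor_ (proj₂ (proj₂ U)) (proj₂ (proj₂ V)))
               (just-injective (trans (sym (cong₂ (zipWith _xor_) entry rest)) member)))
  where
    I : SignedSet
    I = [ k₁ + δ↗ a , k₂ - δ↖ b ⟩
    R : SignedSet
    R = μ⟨ b ∷ as ⟩ (k₂ ∷ ks)
    U = entry-witness a b k₁≤x x<k₂ entry
    V = rowOf-witness (k₂ ∷ ks) (b ∷ as) ls il rest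

=ᵇ⇒≡ : ∀ {x y} → (x =ᵇ y) ≡ true → x ≡ y
=ᵇ⇒≡ {x} {y} h with x ℤ.≟ y
... | yes x≡y = x≡y

=ᵇ-false⇒≢ : ∀ {x y} → (x =ᵇ y) ≡ false → x ≢ y
=ᵇ-false⇒≢ {x} {y} h with x ℤ.≟ y
... | no x≢y = x≢y

suc<⇒<-1 : ∀ {x y} → sucℤ x < y → x < y - 1ℤ
suc<⇒<-1 {x} {y} p = subst (x <_) (ℤ.+-comm ℤ.-1ℤ y) (ℤ.suc[i]≤j⇒i<j (ℤ.i<j⇒i≤pred[j] p))

<-1⇒suc< : ∀ {x y} → x < y - 1ℤ → sucℤ x < y
<-1⇒suc< {x} {y} p = ℤ.i≤pred[j]⇒i<j (ℤ.i<j⇒suc[i]≤j (subst (x <_) (ℤ.+-comm y ℤ.-1ℤ) p))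

interlace⇒increasing : ∀ {m} (l : Vec ℤ m) (k : Vec ℤ (suc m)) → Interlace l k → StrictlyIncreasing l
interlace⇒increasing []           (k₁ ∷ [])           tt = tt
interlace⇒increasing (x ∷ [])     (k₁ ∷ k₂ ∷ [])      _  = tt
interlace⇒increasing (x ∷ y ∷ ls) (k₁ ∷ k₂ ∷ k₃ ∷ ks) (_ , x<k₂ , il@(k₂≤y , _)) =
  ℤ.<-≤-trans x<k₂ k₂≤y , interlace⇒increasing (y ∷ ls) (k₂ ∷ k₃ ∷ ks) il

unpinched⇒gapped : ∀ {m} p (k : Vec ℤ (suc m)) (l : Vec ℤ m) → Interlace l k →
  Unpinched p (atLower k l) (atUpper k l) → Gapped l
unpinched⇒gapped p (k₁ ∷ [])           []           _ _ = tt
unpinched⇒gapped p (k₁ ∷ k₂ ∷ [])      (x ∷ [])     _ _ = tt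
unpinched⇒gapped p (k₁ ∷ k₂ ∷ k₃ ∷ ks) (x ∷ y ∷ ls) (_ , x<k₂ , il@(k₂≤y , _)) (_ , rest@(next , _)) =
  suc<⇒<-1 (gap next) , unpinched⇒gapped (sucℤ x =ᵇ k₂) (k₂ ∷ k₃ ∷ ks) (y ∷ ls) il rest
  where
    gap : ((sucℤ x =ᵇ k₂) ≡ true → (y =ᵇ k₂) ≡ false) → sucℤ x < y
    gap next with sucℤ x ℤ.≟ k₂
    ... | yes refl = ℤ.≤∧≢⇒< k₂≤y (λ e → =ᵇ-false⇒≢ (next refl) (sym e))
    ... | no sx≢k₂ = ℤ.<-≤-trans (ℤ.≤∧≢⇒< (ℤ.i<j⇒suc[i]≤j x<k₂) sx≢k₂) k₂≤y

gapped⇒unpinched : ∀ {m} p (k : Vec ℤ (suc m)) (l : Vec ℤ m) → Interlace l k → Gapped l →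
  (p ≡ true → firstBit (atLower k l) ≡ false) → Unpinched p (atLower k l) (atUpper k l)
gapped⇒unpinched p (k₁ ∷ [])           []           _ _ _ = tt
gapped⇒unpinched p (k₁ ∷ k₂ ∷ [])      (x ∷ [])     _ _ h = h , tt
gapped⇒unpinched p (k₁ ∷ k₂ ∷ k₃ ∷ ks) (x ∷ y ∷ ls) (_ , _ , il) (x<y-1 , g) h =
  h , gapped⇒unpinched (sucℤ x =ᵇ k₂) (k₂ ∷ k₃ ∷ ks) (y ∷ ls) il g next
  where
    next : (sucℤ x =ᵇ k₂) ≡ true → (y =ᵇ k₂) ≡ false
    next e = dec-false (y ℤ.≟ k₂) λ y≡k₂ →
      ℤ.<-irrefl (trans (=ᵇ⇒≡ e) (sym y≡k₂)) (<-1⇒suc< x<y-1)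

noDoublePinch-after : ∀ {m} p w (k : Vec ℤ (suc (suc m))) (l : Vec ℤ (suc m)) (u : Vec ℤ m) →
  Interlace l k → Interlace u l → Gapped (w ∷ u) → (p ≡ true → head k ≤ sucℤ w) →
  NoDoublePinch p (atLower k l) (atUpper k l)
noDoublePinch-after p w (k₁ ∷ k₂ ∷ []) (x ∷ []) [] _ _ _ _ = (λ _ _ _ → refl) , tt
noDoublePinch-after p w (k₁ ∷ k₂ ∷ k₃ ∷ ks) (x ∷ y ∷ ls) (v ∷ us)
                    (_ , _ , il) (x≤v , v<y , iu) (w<v-1 , g) h =
  notDouble , noDoublePinch-after (sucℤ x =ᵇ k₂) v (k₂ ∷ k₃ ∷ ks) (y ∷ ls) us il iu g
                                  (λ e → subst (_≤ sucℤ v) (=ᵇ⇒≡ e) (ℤ.suc-mono x≤v))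
  where
    -- y = k₂ = x + 1 = k₁ + 1 ≤ w + 2 ≤ v < y
    notDouble : p ≡ true → (x =ᵇ k₁) ≡ true → (sucℤ x =ᵇ k₂) ≡ true → (y =ᵇ k₂) ≡ false
    notDouble pt hx hsx = dec-false (y ℤ.≟ k₂) λ y≡k₂ →
      ℤ.<-irrefl refl (ℤ.<-≤-trans v<y
        (ℤ.≤-trans (ℤ.≤-reflexive (trans y≡k₂ (trans (sym (=ᵇ⇒≡ {sucℤ x} hsx)) (cong sucℤ (=ᵇ⇒≡ {x} hx)))))
          (ℤ.≤-trans (ℤ.suc-mono (h pt)) (ℤ.i<j⇒suc[i]≤j (<-1⇒suc< w<v-1)))))

noDoublePinch : ∀ {m} (k : Vec ℤ (suc (suc m))) (l : Vec ℤ (suc m)) (u : Vec ℤ m) →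
  Interlace l k → Interlace u l → Gapped u → NoDoublePinch false (atLower k l) (atUpper k l)
noDoublePinch (k₁ ∷ k₂ ∷ []) (x ∷ []) [] _ _ _ = (λ ()) , tt
noDoublePinch (k₁ ∷ k₂ ∷ k₃ ∷ ks) (x ∷ y ∷ ls) (v ∷ us) (_ , _ , il) (x≤v , _ , iu) g =
  (λ ()) , noDoublePinch-after (sucℤ x =ᵇ k₂) v (k₂ ∷ k₃ ∷ ks) (y ∷ ls) us il iu g
                               (λ e → subst (_≤ sucℤ v) (=ᵇ⇒≡ e) (ℤ.suc-mono x≤v))

Interlace-irrelevant : ∀ {m} (l : Vec ℤ m) (k : Vec ℤ (suc m)) (p q : Interlace l k) → p ≡ q
Interlace-irrelevant []      (k₁ ∷ [])      tt             tt             = refl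
Interlace-irrelevant (x ∷ l) (k₁ ∷ k₂ ∷ k) (p₁ , p₂ , ps) (q₁ , q₂ , qs) =
  cong₂ _,_ (ℤ.≤-irrelevant p₁ q₁) (cong₂ _,_ (ℤ.<-irrelevant p₂ q₂) (Interlace-irrelevant l (k₂ ∷ k) ps qs))

Gapped-irrelevant : ∀ {m} (l : Vec ℤ m) (p q : Gapped l) → p ≡ q
Gapped-irrelevant []           tt       tt       = refl
Gapped-irrelevant (x ∷ [])     tt       tt       = refl
Gapped-irrelevant (x ∷ y ∷ l) (p , ps) (q , qs) = cong₂ _,_ (ℤ.<-irrelevant p q) (Gapped-irrelevant (y ∷ l) ps qs)

Vec-≡-irrelevant : ∀ {m} {u v : Vec ℤ m} (p q : u ≡ v) → p ≡ q
Vec-≡-irrelevant = Decidable⇒UIP.≡-irrelevant (≡-dec ℤ._≟_)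

noDoublePinch-MT : ∀ n (k : Vec ℤ (suc (suc n))) (l : Vec ℤ (suc n)) → Pos (MT n l) → Interlace l k →
  NoDoublePinch false (atLower k l) (atUpper k l)
noDoublePinch-MT zero    (k₁ ∷ k₂ ∷ []) (x ∷ []) _ _ = (λ ()) , tt
noDoublePinch-MT (suc n) k l ((t , b) , refl , _ , il , g) lk = noDoublePinch k l (bottom n t) lk il g

-- The induction step

module Cells (n : ℕ) (k : Vec ℤ (suc (suc n))) (k-increasing : StrictlyIncreasing k) where

  N : ℕ
  N = suc (suc n)

  Box : ∣ AR N ∣ → SignedSet
  Box μ = μ⟨ arrows N μ ⟩ k

  row : (μ : ∣ AR N ∣) → ∣ Box μ ∣ → Vec ℤ (suc n)
  row μ = rowOf (arrows N μ) k

  Fibre : (μ : ∣ AR N ∣) → ∣ Box μ ∣ → SignedSet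
  Fibre μ lv = MT n (row μ lv)

  Column : ∣ AR N ∣ → SignedSet
  Column μ = ⨆ (Box μ) (Fibre μ)

  Cells : SignedSet
  Cells = ⨆ (AR N) Column

  ηFibre : (μ : ∣ AR N ∣) (lv : ∣ Box μ ∣) → ∣ Fibre μ lv ∣ → Tri (suc n)
  ηFibre μ lv s = ηMT n (row μ lv) s , k

  ηCells : ∣ Cells ∣ → Tri (suc n)
  ηCells = ⨆η {S = Column} (λ μ → ⨆η {S = Fibre μ} (ηFibre μ))

  Fixed : Set
  Fixed = Pos (MT (suc n) k)

  cell : (μ : ∣ AR N ∣) (lv : ∣ Box μ ∣) (t : Tri n) → bottom n t ≡ row μ lv → IsMT n t → ∣ Cells ∣
  cell μ lv t p im = pair {S = Column} (μ , pair {S = Fibre μ} (lv , inj₁ (t , p , im)))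

  cell-elim : (P : ∣ Cells ∣ → Set) → (∀ μ lv t p im → P (cell μ lv t p im)) → ∀ x → P x
  cell-elim P h x = subst P (pair-unpair {S = Column} x) (column (unpair {S = Column} x))
    where
      fibre : ∀ μ (z : Σ ∣ Box μ ∣ (λ lv → ∣ Fibre μ lv ∣)) → P (pair {S = Column} (μ , pair {S = Fibre μ} z))
      fibre μ (lv , inj₁ (t , p , im)) = h μ lv t p im
      column : (y : Σ ∣ AR N ∣ (λ μ → ∣ Column μ ∣)) → P (pair {S = Column} y)
      column (μ , y) = subst (λ y → P (pair {S = Column} (μ , y))) (pair-unpair {S = Fibre μ} y)
                             (fibre μ (unpair {S = Fibre μ} y))

  cell-cong : ∀ {μ μ′} (lv : ∣ Box μ ∣) (lv′ : ∣ Box μ′ ∣) t p p′ im → μ ≡ μ′ →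
    cell μ lv t p im ≡ cell μ′ lv′ t p′ im
  cell-cong {μ} lv lv′ t p p′ im refl with values-unique _ _ lv lv′ (trans (sym p) p′)
  ... | refl = cong (λ q → cell μ lv t q im) (Vec-≡-irrelevant p p′)

  isNeg-cell : ∀ μ lv t p im → isNeg (cell μ lv t p im) ≡ parity (arrows N μ) xor isNeg lv
  isNeg-cell μ lv t p im = begin
    isNeg (cell μ lv t p im)                        ≡⟨ isNeg-pair {S = Column} μ inner ⟩
    isNeg μ xor isNeg inner                         ≡⟨ cong (isNeg μ xor_) (isNeg-pair {S = Fibre μ} lv _) ⟩
    isNeg μ xor (isNeg lv xor false)                ≡⟨ cong₂ _xor_ (isNeg-AR N μ) (xor-identityʳ (isNeg lv)) ⟩
    parity (arrows N μ) xor isNeg lv                ∎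
    where
      open ≡-Reasoning
      inner : ∣ Column μ ∣
      inner = pair {S = Fibre μ} (lv , inj₁ (t , p , im))

  ηCells-cell : ∀ μ lv t p im → ηCells (cell μ lv t p im) ≡ (t , k)
  ηCells-cell μ lv t p im =
    trans (⨆η-pair {S = Column} (λ μ → ⨆η {S = Fibre μ} (ηFibre μ)) μ (pair {S = Fibre μ} (lv , inj₁ (t , p , im))))
          (⨆η-pair {S = Fibre μ} (ηFibre μ) lv (inj₁ (t , p , im)))

  Ls Rs : Tri n → Vec Bool (suc n)
  Ls t = atLower k (bottom n t)
  Rs t = atUpper k (bottom n t)

  rowFacts : ∀ μ lv t → bottom n t ≡ row μ lv →
    rowMembership (arrows N μ) (Ls t) (Rs t) ≡ just (isNeg lv) × Interlace (bottom n t) k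
  rowFacts μ lv t p =
    subst (λ l → rowMembership (arrows N μ) (atLower k l) (atUpper k l) ≡ just (isNeg lv) × Interlace l k)
          (sym p) (rowOf-membership k (arrows N μ) k-increasing lv)

  boxWith : ∀ α l {s} → Interlace l k → rowMembership α (atLower k l) (atUpper k l) ≡ just s →
    Σ ∣ Box (fromArrows N α) ∣ (λ lv → row (fromArrows N α) lv ≡ l × isNeg lv ≡ s)
  boxWith α l {s} il h =
    rowOf-witness k (arrows N (fromArrows N α)) l il
      (subst (λ β → rowMembership β (atLower k l) (atUpper k l) ≡ just s) (sym (arrows-fromArrows N α)) h)

  cellWith : ∀ α t im {s} → Interlace (bottom n t) k → rowMembership α (Ls t) (Rs t) ≡ just s → ∣ Cells ∣
  cellWith α t im il h = cell (fromArrows N α) (proj₁ B) t (sym (proj₁ (proj₂ B))) im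
    where B = boxWith α (bottom n t) il h

  partner : ∀ μ lv t (p : bottom n t ≡ row μ lv) im α′ → switch false (arrows N μ) (Ls t) (Rs t) ≡ just α′ →
    ∣ Cells ∣
  partner μ lv t p im α′ e =
    cellWith α′ t im (proj₂ facts) (trans (switch-membership false (arrows N μ) α′ (Ls t) (Rs t) e) (proj₁ facts))
    where facts = rowFacts μ lv t p

  fixed-canonical : ∀ μ lv t (p : bottom n t ≡ row μ lv) im → switch false (arrows N μ) (Ls t) (Rs t) ≡ nothing →
    Unpinched false (Ls t) (Rs t) × arrows N μ ≡ canonical false (Ls t) (Rs t)
  fixed-canonical μ lv t p im e =
    switch-fixed⇒canonical false (arrows N μ) (Ls t) (Rs t) e (proj₁ facts) (λ ())
      (noDoublePinch-MT n k (bottom n t) (t , refl , im) (proj₂ facts))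
    where facts = rowFacts μ lv t p

  fixedPoint : ∀ μ lv t (p : bottom n t ≡ row μ lv) im → switch false (arrows N μ) (Ls t) (Rs t) ≡ nothing → Fixed
  fixedPoint μ lv t p im e =
    (t , k) , refl , im , il , unpinched⇒gapped false k (bottom n t) il (proj₁ (fixed-canonical μ lv t p im e))
    where il = proj₂ (rowFacts μ lv t p)

  resolve : ∀ μ lv t (p : bottom n t ≡ row μ lv) im (r : Maybe (Vec Arrow N)) →
    switch false (arrows N μ) (Ls t) (Rs t) ≡ r → ∣ Cells ∣ ⊎ Fixed
  resolve μ lv t p im (just α′) e = inj₁ (partner μ lv t p im α′ e)
  resolve μ lv t p im nothing   e = inj₂ (fixedPoint μ lv t p im e)

  ιColumn : (μ : ∣ AR N ∣) → Σ ∣ Box μ ∣ (λ lv → ∣ Fibre μ lv ∣) → ∣ Cells ∣ ⊎ Fixed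
  ιColumn μ (lv , inj₁ (t , p , im)) = resolve μ lv t p im _ refl

  ι : ∣ Cells ∣ → ∣ Cells ∣ ⊎ Fixed
  ι x = ιColumn (proj₁ (unpair {S = Column} x)) (unpair {S = Fibre _} (proj₂ (unpair {S = Column} x)))

  ι-cell : ∀ μ lv t p im {r} (e : switch false (arrows N μ) (Ls t) (Rs t) ≡ r) →
    ι (cell μ lv t p im) ≡ resolve μ lv t p im r e
  ι-cell μ lv t p im e = begin
    ι (cell μ lv t p im)
      ≡⟨ cong (λ (μ , y) → ιColumn μ (unpair {S = Fibre μ} y)) (unpair-pair {S = Column} (μ , inner)) ⟩
    ιColumn μ (unpair {S = Fibre μ} inner)
      ≡⟨ cong (ιColumn μ) (unpair-pair {S = Fibre μ} (lv , inj₁ (t , p , im))) ⟩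
    resolve μ lv t p im _ refl
      ≡⟨ resolve-at e ⟩
    resolve μ lv t p im _ e ∎
    where
      open ≡-Reasoning
      inner : ∣ Column μ ∣
      inner = pair {S = Fibre μ} (lv , inj₁ (t , p , im))
      resolve-at : ∀ {r} (e : switch false (arrows N μ) (Ls t) (Rs t) ≡ r) →
        resolve μ lv t p im _ refl ≡ resolve μ lv t p im r e
      resolve-at refl = refl

  Paired Settled : ∀ μ lv t (p : bottom n t ≡ row μ lv) im → Set
  Paired μ lv t p im = Σ[ α′ ∈ Vec Arrow N ] Σ[ e ∈ switch false (arrows N μ) (Ls t) (Rs t) ≡ just α′ ]
                         ι (cell μ lv t p im) ≡ inj₁ (partner μ lv t p im α′ e)
  Settled μ lv t p im = Σ[ e ∈ switch false (arrows N μ) (Ls t) (Rs t) ≡ nothing ]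
                          ι (cell μ lv t p im) ≡ inj₂ (fixedPoint μ lv t p im e)

  resolution : ∀ μ lv t p im → Paired μ lv t p im ⊎ Settled μ lv t p im
  resolution μ lv t p im = from _ refl
    where
      from : ∀ r (e : switch false (arrows N μ) (Ls t) (Rs t) ≡ r) → Paired μ lv t p im ⊎ Settled μ lv t p im
      from (just α′) e = inj₁ (α′ , e , ι-cell μ lv t p im e)
      from nothing   e = inj₂ (e , ι-cell μ lv t p im e)

  partnerOf : ∀ μ lv t p im {y} → ι (cell μ lv t p im) ≡ inj₁ y →
    Σ[ α′ ∈ Vec Arrow N ] Σ[ e ∈ switch false (arrows N μ) (Ls t) (Rs t) ≡ just α′ ] partner μ lv t p im α′ e ≡ y
  partnerOf μ lv t p im {y} h = [ paired , (λ (e , r) → ⊥-elim (inj₂≢inj₁ (trans (sym r) h))) ]′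
                                  (resolution μ lv t p im)
    where
      paired : Paired μ lv t p im →
        Σ[ α′ ∈ Vec Arrow N ] Σ[ e ∈ switch false (arrows N μ) (Ls t) (Rs t) ≡ just α′ ] partner μ lv t p im α′ e ≡ y
      paired (α′ , e , r) = α′ , e , inj₁-injective (trans (sym r) h)

  fixedPointOf : ∀ μ lv t p im {f} → ι (cell μ lv t p im) ≡ inj₂ f →
    Σ[ e ∈ switch false (arrows N μ) (Ls t) (Rs t) ≡ nothing ] fixedPoint μ lv t p im e ≡ f
  fixedPointOf μ lv t p im {f} h = [ (λ (_ , _ , r) → ⊥-elim (inj₂≢inj₁ (trans (sym h) r))) , settled ]′
                                     (resolution μ lv t p im)
    where
      settled : Settled μ lv t p im →
        Σ[ e ∈ switch false (arrows N μ) (Ls t) (Rs t) ≡ nothing ] fixedPoint μ lv t p im e ≡ f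
      settled (e , r) = e , inj₂-injective (trans (sym r) h)

  embed : Fixed → ∣ Cells ∣
  embed ((t , _) , refl , im , il , g) =
    cellWith (canonical false (Ls t) (Rs t)) t im il
      (canonical-membership false (Ls t) (Rs t) (gapped⇒unpinched false k (bottom n t) il g (λ ())))

  partner-involutive : ∀ μ lv t p im α′ (e : switch false (arrows N μ) (Ls t) (Rs t) ≡ just α′) →
    ι (partner μ lv t p im α′ e) ≡ inj₁ (cell μ lv t p im)
  partner-involutive μ lv t p im α′ e =
    trans (ι-cell (fromArrows N α′) _ t _ im back) (cong inj₁ (cell-cong _ lv t _ p im (fromArrows-arrows N μ)))
    where
      back : switch false (arrows N (fromArrows N α′)) (Ls t) (Rs t) ≡ just (arrows N μ)
      back = trans (cong (λ β → switch false β (Ls t) (Rs t)) (arrows-fromArrows N α′))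
                   (switch-involutive false (arrows N μ) α′ (Ls t) (Rs t) e)

  partner-flips : ∀ μ lv t p im α′ (e : switch false (arrows N μ) (Ls t) (Rs t) ≡ just α′) →
    isNeg (partner μ lv t p im α′ e) ≡ not (isNeg (cell μ lv t p im))
  partner-flips μ lv t p im α′ e = begin
    isNeg (partner μ lv t p im α′ e)                     ≡⟨ isNeg-cell (fromArrows N α′) lv′ t _ im ⟩
    parity (arrows N (fromArrows N α′)) xor isNeg lv′    ≡⟨ cong₂ _xor_ (cong parity (arrows-fromArrows N α′))
                                                                         (proj₂ (proj₂ B)) ⟩
    parity α′ xor isNeg lv                               ≡⟨ cong (_xor isNeg lv)
                                                              (switch-flips false (arrows N μ) α′ (Ls t) (Rs t) e) ⟩
    not (parity (arrows N μ)) xor isNeg lv               ≡⟨ not-distribˡ-xor (parity (arrows N μ)) (isNeg lv) ⟨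
    not (parity (arrows N μ) xor isNeg lv)               ≡⟨ cong not (isNeg-cell μ lv t p im) ⟨
    not (isNeg (cell μ lv t p im))                       ∎
    where
      open ≡-Reasoning
      facts = rowFacts μ lv t p
      B = boxWith α′ (bottom n t) (proj₂ facts)
            (trans (switch-membership false (arrows N μ) α′ (Ls t) (Rs t) e) (proj₁ facts))
      lv′ = proj₁ B

  fixedPoint-embed : ∀ μ lv t p im (e : switch false (arrows N μ) (Ls t) (Rs t) ≡ nothing) →
    embed (fixedPoint μ lv t p im e) ≡ cell μ lv t p im
  fixedPoint-embed μ lv t p im e =
    cell-cong _ lv t _ p im
      (trans (cong (fromArrows N) (sym (proj₂ (fixed-canonical μ lv t p im e)))) (fromArrows-arrows N μ))

  ι-involutive : ∀ {x y} → ι x ≡ inj₁ y → ι y ≡ inj₁ x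
  ι-involutive {x} {y} = cell-elim (λ x → ι x ≡ inj₁ y → ι y ≡ inj₁ x) involutive x
    where
      involutive : ∀ μ lv t p im → ι (cell μ lv t p im) ≡ inj₁ y → ι y ≡ inj₁ (cell μ lv t p im)
      involutive μ lv t p im h =
        let α′ , e , q = partnerOf μ lv t p im h in
        subst (λ y → ι y ≡ inj₁ (cell μ lv t p im)) q (partner-involutive μ lv t p im α′ e)

  ι-flips : ∀ {x y} → ι x ≡ inj₁ y → isNeg y ≡ not (isNeg x)
  ι-flips {x} {y} = cell-elim (λ x → ι x ≡ inj₁ y → isNeg y ≡ not (isNeg x)) flips x
    where
      flips : ∀ μ lv t p im → ι (cell μ lv t p im) ≡ inj₁ y → isNeg y ≡ not (isNeg (cell μ lv t p im))
      flips μ lv t p im h =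
        let α′ , e , q = partnerOf μ lv t p im h in
        subst (λ y → isNeg y ≡ not (isNeg (cell μ lv t p im))) q (partner-flips μ lv t p im α′ e)

  ι-compatible : ∀ {x y} → ι x ≡ inj₁ y → ηCells y ≡ ηCells x
  ι-compatible {x} {y} = cell-elim (λ x → ι x ≡ inj₁ y → ηCells y ≡ ηCells x) compatible x
    where
      compatible : ∀ μ lv t p im → ι (cell μ lv t p im) ≡ inj₁ y → ηCells y ≡ ηCells (cell μ lv t p im)
      compatible μ lv t p im h =
        let α′ , e , q = partnerOf μ lv t p im h in
        subst (λ y → ηCells y ≡ ηCells (cell μ lv t p im)) q
              (trans (ηCells-cell (fromArrows N α′) _ t _ im) (sym (ηCells-cell μ lv t p im)))

  ι-fixed : ∀ {x f} → ι x ≡ inj₂ f → embed f ≡ x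
  ι-fixed {x} {f} = cell-elim (λ x → ι x ≡ inj₂ f → embed f ≡ x) fixed x
    where
      fixed : ∀ μ lv t p im → ι (cell μ lv t p im) ≡ inj₂ f → embed f ≡ cell μ lv t p im
      fixed μ lv t p im h =
        let e , q = fixedPointOf μ lv t p im h in
        subst (λ f → embed f ≡ cell μ lv t p im) q (fixedPoint-embed μ lv t p im e)

  ι-embed : ∀ f → ι (embed f) ≡ inj₂ f
  ι-embed ((t , _) , refl , im , il , g) =
    trans (ι-cell (fromArrows N c) _ t _ im settled)
          (cong (λ (il , g) → inj₂ ((t , k) , refl , im , il , g))
                (cong₂ _,_ (Interlace-irrelevant _ k _ il) (Gapped-irrelevant _ _ g)))
    where
      c : Vec Arrow N
      c = canonical false (Ls t) (Rs t)
      settled : switch false (arrows N (fromArrows N c)) (Ls t) (Rs t) ≡ nothing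
      settled = trans (cong (λ β → switch false β (Ls t) (Rs t)) (arrows-fromArrows N c))
                      (switch-canonical false (Ls t) (Rs t))

  embed-positive : ∀ f → isNeg (embed f) ≡ false
  embed-positive ((t , _) , refl , im , il , g) =
    trans (isNeg-cell (fromArrows N c) _ t _ im)
          (cong₂ _xor_ (trans (cong parity (arrows-fromArrows N c)) (canonical-parity false (Ls t) (Rs t)))
                       (proj₂ (proj₂ (boxWith c (bottom n t) il canonicalMember))))
    where
      c : Vec Arrow N
      c = canonical false (Ls t) (Rs t)
      canonicalMember : rowMembership c (Ls t) (Rs t) ≡ just false
      canonicalMember = canonical-membership false (Ls t) (Rs t) (gapped⇒unpinched false k (bottom n t) il g (λ ()))

  involution : SignReversingInvolution Cells Fixed ηCells
  involution = record
    { ι              = ι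
    ; embed          = embed
    ; ι-involutive   = λ {x} {y} → ι-involutive {x} {y}
    ; ι-flips        = λ {x} {y} → ι-flips {x} {y}
    ; ι-compatible   = λ {x} {y} → ι-compatible {x} {y}
    ; ι-fixed        = λ {x} {f} → ι-fixed {x} {f}
    ; ι-embed        = ι-embed
    ; embed-positive = embed-positive
    }

  embed-statistic : ∀ f → ηMT (suc n) k (inj₁ f) ≡ ηCells (embed f)
  embed-statistic ((t , _) , refl , im , il , g) =
    sym (ηCells-cell (fromArrows N c) (proj₁ B) t (sym (proj₁ (proj₂ B))) im)
    where
      c : Vec Arrow N
      c = canonical false (Ls t) (Rs t)
      B = boxWith c (bottom n t) il
            (canonical-membership false (Ls t) (Rs t) (gapped⇒unpinched false k (bottom n t) il g (λ ())))

module Base (k : Vec ℤ 1) where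

  ι : ∣ AR₁ ∣ → ∣ AR₁ ∣ ⊎ Pos (MT 0 k)
  ι (inj₁ pos↖)  = inj₂ (k , refl , tt)
  ι (inj₁ pos↗)  = inj₁ (inj₂ neg↖↗)
  ι (inj₂ neg↖↗) = inj₁ (inj₁ pos↗)

  involution : SignReversingInvolution AR₁ (Pos (MT 0 k)) (ηGMT 0 k)
  involution = record
    { ι              = ι
    ; embed          = λ _ → inj₁ pos↖
    ; ι-involutive   = involutive
    ; ι-flips        = flips
    ; ι-compatible   = λ _ → refl
    ; ι-fixed        = fixed
    ; ι-embed        = λ { (_ , refl , tt) → refl }
    ; embed-positive = λ _ → refl
    }
    where
      involutive : ∀ {x y} → ι x ≡ inj₁ y → ι y ≡ inj₁ x
      involutive {inj₁ pos↗}  refl = refl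
      involutive {inj₂ neg↖↗} refl = refl
      flips : ∀ {x y} → ι x ≡ inj₁ y → isNeg y ≡ not (isNeg x)
      flips {inj₁ pos↗}  refl = refl
      flips {inj₂ neg↖↗} refl = refl
      fixed : ∀ {x f} → ι x ≡ inj₂ f → inj₁ pos↖ ≡ x
      fixed {inj₁ pos↖}  refl = refl
      fixed {inj₂ neg↖↗} ()

  embed-statistic : ∀ f → ηMT 0 k (inj₁ f) ≡ k
  embed-statistic (_ , p , tt) = p

MT⇒GMT : ∀ n (k : Vec ℤ (suc n)) → StrictlyIncreasing k →
  CompatibleSijection (MT n k) (GMT n k) (ηMT n k) (ηGMT n k)
MT⇒GMT zero    k _   = signReversing⇒sijection (Base.involution k) (ηMT 0 k) (Base.embed-statistic k)
MT⇒GMT (suc n) k inc =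
  compose (signReversing⇒sijection involution (ηMT (suc n) k) embed-statistic)
          (⨆-sijection columnSijection)
          (⨆-forward columnSijection λ μ →
             ⨆-forward (fibreSijection μ) λ lv → unsigned-forward (fibreSijection μ lv))
  where
    open Cells n k inc
    fibreSijection : ∀ μ lv →
      CompatibleSijection (Fibre μ lv) (GMT n (row μ lv)) (ηFibre μ lv) (λ z → ηGMT n (row μ lv) z , k)
    fibreSijection μ lv =
      mapStatistic (MT⇒GMT n (row μ lv) (interlace⇒increasing _ k (proj₂ (rowOf-membership k (arrows N μ) inc lv))))
                   (_, k)
    columnSijection : ∀ μ → CompatibleSijection (Column μ) (⨆ (Box μ) (λ lv → GMT n (row μ lv)))
                                                 (⨆η {S = Fibre μ} (ηFibre μ))
                                                 (⨆η {S = λ lv → GMT n (row μ lv)} (λ lv z → ηGMT n (row μ lv) z , k))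
    columnSijection μ = ⨆-sijection (fibreSijection μ)

mainTheorem7 : (n : ℕ) (k : Vec ℤ (suc n)) → StrictlyIncreasing k →
    Σ (Sijection (MT n k) (GMT n k)) (λ f → Compatible (ηMT n k) (ηGMT n k) f)
mainTheorem7 n k inc = toSijection (MT⇒GMT n k inc)
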